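{- Let $k,r\ge2$. For every $\beta>0$ and $1\le\ell<k$ there exist $\gamma>0$ and $n_0\in\mathbb N$ such that the following holds. Let $H\in\mathcal F^\ast_{k,r}$ be an $r$-edge-coloured $k$-graph on $n\ge n_0$ vertices which has a perfect matching with at most $n/(rk)+\gamma n$ edges of each colour. Then $\delta_\ell(H)\le (f_{\ell,k,r}+\beta)\binom{n-\ell}{k-\ell}$.
   Context: A $k$-graph $H$ has vertex set $V(H)$ and edges which are $k$-subsets of $V(H)$; $\delta_\ell(H)$ is the largest $m$ such that every $\ell$-set of vertices lies in at least $m$ edges. Given a partition $\{V_1,\dots,V_r\}$ of $V(H)$, an edge $e$ has type $(j_1,\dots,j_r)$ if $|e\cap V_i|=j_i$ for all $i$; $\mathbf e_i$ is the $i$th standard unit vector of $\mathbb Z^r$. $(\mathbf j,\sigma)$ with $\mathbf j\in\mathbb N_0^r$, $\sigma\in\{ -1,1\}$ is $k$-valid if $\sigma+\sum_i j_i=k$ and $j_i+\sigma\ge0$ for all $i$. An $r$-edge-coloured $k$-graph $H$ is in $\mathcal F^\ast_{k,r}(\mathbf j,\sigma)$ if there is a partition $\{V_1,\dots,V_r\}$ of $V(H)$ such that for each $i\in[r]$ every edge of colour $i$ has type $\mathbf j+\sigma\mathbf e_i$; it is in $\mathcal F_{k,r}(\mathbf j,\sigma)$ if additionally $n=|V(H)|$ is divisible by $kr$ and $|V_i|=\frac{rj_i+\sigma}{rk}n$ for all $i$. $\mathcal F^\ast_{k,r}$ and $\mathcal F_{k,r}$ are the respective unions over all $k$-valid pairs,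 and \[f_{\ell,k,r}:=\lim_{n\to\infty}\max_{H\in\mathcal F_{k,r},\,|V(H)|=krn}\frac{\delta_\ell(H)}{\binom{|V(H)|-\ell}{k-\ell}}.\]
   Formalization: The parameter β ranges over the positive rationals. -}

module Defs where

open import Data.Nat as ℕ using (ℕ; _≤_; _<_; _∸_)
open import Data.Nat.Divisibility using (_∣_)
open import Data.Nat.Combinatorics using (_C_)
open import Data.Integer as ℤ using (ℤ; +_; -_)
open import Data.Rational as ℚ using (ℚ)
open import Data.Fin using (Fin)
open import Data.Fin.Properties using (_≟_)
open import Data.Fin.Subset using (Subset; ∣_∣; _∩_; _⊆_; _∈_)
open import Data.Fin.Subset.Properties using (_⊆?_)
open import Data.Bool using (Bool; if_then_else_)
open import Data.List using (List; map; filter; length; tabulate)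
open import Data.Nat.ListAction using (sum)
open import Data.List.Relation.Unary.All using (All)
open import Data.List.Relation.Unary.Any using (Any)
open import Data.List.Relation.Unary.AllPairs using (AllPairs)
open import Data.List.Relation.Unary.Unique.Propositional using (Unique)
open import Data.List.Membership.Propositional renaming (_∈_ to _∈ₗ_)
open import Data.Product using (Σ; _×_; _,_; proj₁; proj₂; ∃; ∃-syntax)
open import Data.Sum using (_⊎_)
open import Data.Vec using (Vec)
import Data.Vec as Vec
open import Relation.Nullary using (¬_; Dec; yes; no)
open import Relation.Nullary.Decidable using (⌊_⌋)
open import Relation.Binary.PropositionalEquality using (_≡_)

ℕ→ℚ : ℕ → ℚ
ℕ→ℚ n = + n ℚ./ 1

CEdge : ℕ → ℕ → Set
CEdge r n = Subset n × Fin r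

record CGraph (k r n : ℕ) : Set where
  field
    edges    : List (CEdge r n)
    distinct : Unique (map proj₁ edges)
    uniform  : All (λ e → ∣ proj₁ e ∣ ≡ k) edges
open CGraph public

deg : ∀ {k r n} → CGraph k r n → Subset n → ℕ
deg H S = length (filter (λ e → S ⊆? proj₁ e) (edges H))

-- "every ℓ-set lies in at least m edges"; δ_ℓ(H) is the largest such m.
MinDegAtLeast : ∀ {k r n} → CGraph k r n → ℕ → ℕ → Set
MinDegAtLeast {n = n} H ℓ m = (S : Subset n) → ∣ S ∣ ≡ ℓ → m ≤ deg H S

part : ∀ {r n} → (Fin n → Fin r) → Fin r → Subset n
part p i = Vec.tabulate (λ v → ⌊ p v ≟ i ⌋)

Valid : (k r : ℕ) → (Fin r → ℕ) → ℤ → Set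
Valid k r j σ = (σ ≡ + 1 ⊎ σ ≡ - (+ 1))
              × (σ ℤ.+ + sum (tabulate j) ≡ + k)
              × ((i : Fin r) → + 0 ℤ.≤ + j i ℤ.+ σ)

shifted : ∀ {r} → (Fin r → ℕ) → ℤ → Fin r → Fin r → ℤ
shifted j σ c i = + j i ℤ.+ (if ⌊ i ≟ c ⌋ then σ else + 0)

EdgesTyped : ∀ {k r n} → CGraph k r n → (Fin n → Fin r) → (Fin r → ℕ) → ℤ → Set
EdgesTyped {r = r} H p j σ =
  All (λ e → (i : Fin r) → + ∣ proj₁ e ∩ part p i ∣ ≡ shifted j σ (proj₂ e) i) (edges H)

InFstar : ∀ {k r n} → CGraph k r n → Set
InFstar {k} {r} {n} H =
  Σ (Fin r → ℕ) λ j → Σ ℤ λ σ → Valid k r j σ ×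
    Σ (Fin n → Fin r) λ p → EdgesTyped H p j σ

InF : ∀ {k r n} → CGraph k r n → Set
InF {k} {r} {n} H =
  Σ (Fin r → ℕ) λ j → Σ ℤ λ σ → Valid k r j σ ×
    Σ (Fin n → Fin r) λ p → EdgesTyped H p j σ
      × (k ℕ.* r ∣ n)
      × ((i : Fin r) → + (∣ part p i ∣ ℕ.* (r ℕ.* k)) ≡ (+ (r ℕ.* j i) ℤ.+ σ) ℤ.* + n)

PerfectMatching : ∀ {k r n} → CGraph k r n → List (CEdge r n) → Set
PerfectMatching {n = n} H M =
    All (λ e → e ∈ₗ edges H) M
  × AllPairs (λ e f → (v : Fin n) → v ∈ proj₁ e → ¬ (v ∈ proj₁ f)) M
  × ((v : Fin n) → Any (λ e → v ∈ proj₁ e) M)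

colourCount : ∀ {r n} → List (CEdge r n) → Fin r → ℕ
colourCount M i = length (filter (λ e → proj₂ e ≟ i) M)

-- "d ≤ (f_{ℓ,k,r} + β) · B", where B > 0 (we use B = C(n-ℓ,k-ℓ)),
-- f_{ℓ,k,r} = lim_m a_m and
-- a_m = max_{H ∈ F_{k,r}, |V(H)| = krm} δ_ℓ(H) / C(krm-ℓ, k-ℓ).
-- Unfolded (multiplied out by the positive binomials) as
-- d/B - β ≤ liminf_m a_m: for every ε > 0, for all large m there is
-- H' ∈ F_{k,r} on krm vertices and d' with δ_ℓ(H') ≥ d' and
-- (d/B - β - ε) · C(krm-ℓ,k-ℓ) ≤ d', i.e.
-- (d - (β + ε)·B) · C(krm-ℓ,k-ℓ) ≤ d' · B.
DegAtMostFPlus : (ℓ k r : ℕ) → (d B : ℕ) → (β : ℚ) → Set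
DegAtMostFPlus ℓ k r d B β =
  (ε : ℚ) → ℚ.0ℚ ℚ.< ε →
  ∃[ M ] ((m : ℕ) → M ≤ m →
    Σ (CGraph k r (k ℕ.* r ℕ.* m)) λ H → InF H ×
      ∃[ d' ] (MinDegAtLeast H ℓ d'
             × ((ℕ→ℚ d ℚ.- (β ℚ.+ ε) ℚ.* ℕ→ℚ B)
                   ℚ.* ℕ→ℚ (((k ℕ.* r ℕ.* m) ∸ ℓ) C (k ∸ ℓ))
                ℚ.≤ ℕ→ℚ d' ℚ.* ℕ→ℚ B)))

-- Let V₁,…,V_r be the partition witnessing H ∈ F*_{k,r}, so that every edge of colour c has type
-- t_c = j + σe_c. Covering V_i by the perfect matching gives |V_i| ≤ Σ_c t_c(i)|M_c|, and the
-- balance of M then forces |V_i| ≈ w_i n/rk with w_i = r j_i + σ for every i. An ℓ-set S of type s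
-- lies in at most Σ_c Π_i C(|V_i ∖ S|, t_c(i) − s_i) edges of H. The complete member of F_{k,r} on
-- krm vertices (every set of some type t_c, coloured c) has parts of size exactly w_i m, and an
-- ℓ-set of type s lies in exactly Σ_c Π_i C(|V′_i ∖ S′|, t_c(i) − s_i) of its edges. Normalised by
-- C(n − ℓ, k − ℓ) and C(krm − ℓ, k − ℓ), both sums equal Σ_c (k − ℓ)!/Π_i u_i! · Π_i (w_i/rk)^{u_i}
-- (u = t_c − s) up to an error that the choice of γ, n₀ and m makes smaller than β, so the
-- normalised ℓ-degree of H is below that of the complete graph plus β.

module Submission where

open import Defs
open import Data.Nat using (ℕ; _≤_; _<_; _∸_; _*_)
open import Data.Nat.Combinatorics using (_C_)
open import Data.Rational using (ℚ; 0ℚ; _/_) renaming (_<_ to _<ℚ_; _≤_ to _≤ℚ_; _+_ to _+ℚ_; _-_ to _-ℚ_; _*_ to _*ℚ_)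
open import Data.Fin using (Fin)
open import Data.List using (List)
open import Data.Product using (Σ; _×_; ∃-syntax)
open import Data.Product using (_,_; proj₁; proj₂)

module Filtering where

  open import Data.Nat using (suc; _+_; _≤_; z≤n; s≤s)
  open import Data.Nat.Properties
  open import Data.List using (List; []; _∷_; _++_; map; filter; length)
  open import Data.List.Properties using (filter-++; length-++)
  open import Data.List.Membership.Propositional using (_∈_)
  open import Data.List.Relation.Unary.All as All using (All; []; _∷_)
  import Data.List.Relation.Unary.All.Properties as All
  open import Data.List.Relation.Unary.Any using (here; there)
  open import Data.List.Relation.Unary.Unique.Propositional using (Unique; []; _∷_)
  open import Relation.Nullary using (¬_; yes; no; does)
  open import Relation.Unary using (Pred; Decidable)
  open import Relation.Binary.PropositionalEquality
  open import Data.Empty using (⊥-elim)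
  open import Function using (_∘_)
  open import Data.Product using (_,_)
  open import Data.Bool using (true; false; if_then_else_)
  open import Level using (0ℓ)

  module _ {A : Set} where

    length-filter-++ : ∀ {P : Pred A 0ℓ} (P? : Decidable P) xs ys →
                       length (filter P? (xs ++ ys)) ≡ length (filter P? xs) + length (filter P? ys)
    length-filter-++ P? xs ys = trans (cong length (filter-++ P? xs ys)) (length-++ (filter P? xs))

    length-filter-mono : ∀ {P Q : Pred A 0ℓ} (P? : Decidable P) (Q? : Decidable Q) →
                         (∀ {x} → P x → Q x) → ∀ xs → length (filter P? xs) ≤ length (filter Q? xs)
    length-filter-mono P? Q? P⇒Q [] = z≤n
    length-filter-mono P? Q? P⇒Q (x ∷ xs) with P? x | Q? x
    ... | yes px | yes _  = s≤s (length-filter-mono P? Q? P⇒Q xs)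
    ... | yes px | no ¬qx = ⊥-elim (¬qx (P⇒Q px))
    ... | no _   | yes _  = m≤n⇒m≤1+n (length-filter-mono P? Q? P⇒Q xs)
    ... | no _   | no _   = length-filter-mono P? Q? P⇒Q xs

    length-filter-cong : ∀ {P Q : Pred A 0ℓ} (P? : Decidable P) (Q? : Decidable Q) →
                         (∀ {x} → P x → Q x) → (∀ {x} → Q x → P x) →
                         ∀ xs → length (filter P? xs) ≡ length (filter Q? xs)
    length-filter-cong P? Q? P⇒Q Q⇒P xs =
      ≤-antisym (length-filter-mono P? Q? P⇒Q xs) (length-filter-mono Q? P? Q⇒P xs)

    length-filter-none : ∀ {P : Pred A 0ℓ} (P? : Decidable P) → (∀ {x} → ¬ P x) →
                         ∀ xs → length (filter P? xs) ≡ 0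
    length-filter-none P? ¬P [] = refl
    length-filter-none P? ¬P (x ∷ xs) with P? x
    ... | yes px = ⊥-elim (¬P px)
    ... | no _   = length-filter-none P? ¬P xs

    private
      remove : ∀ {x : A} ys → x ∈ ys → List A
      remove (y ∷ ys) (here _)  = ys
      remove (y ∷ ys) (there p) = y ∷ remove ys p

      length-remove : ∀ {x : A} ys (p : x ∈ ys) → suc (length (remove ys p)) ≡ length ys
      length-remove (y ∷ ys) (here _)  = refl
      length-remove (y ∷ ys) (there p) = cong suc (length-remove ys p)

      ∈-remove : ∀ {x z : A} ys (p : x ∈ ys) → z ∈ ys → z ≢ x → z ∈ remove ys p
      ∈-remove (y ∷ ys) (here refl) (here refl) z≢x = ⊥-elim (z≢x refl)
      ∈-remove (y ∷ ys) (here refl) (there q)   z≢x = q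
      ∈-remove (y ∷ ys) (there p)   (here z≡y)  z≢x = here z≡y
      ∈-remove (y ∷ ys) (there p)   (there q)   z≢x = there (∈-remove ys p q z≢x)

    Unique-⊆⇒length-≤ : ∀ (xs ys : List A) → Unique xs → All (_∈ ys) xs → length xs ≤ length ys
    Unique-⊆⇒length-≤ []       ys _          _          = z≤n
    Unique-⊆⇒length-≤ (x ∷ xs) ys (x∉xs ∷ u) (x∈ys ∷ xs⊆ys) = begin
      suc (length xs)                ≤⟨ s≤s (Unique-⊆⇒length-≤ xs (remove ys x∈ys) u xs⊆ys-x) ⟩
      suc (length (remove ys x∈ys))  ≡⟨ length-remove ys x∈ys ⟩
      length ys                      ∎
      where
      open ≤-Reasoning
      xs⊆ys-x : All (_∈ remove ys x∈ys) xs
      xs⊆ys-x = All.zipWith (λ (x≢z , z∈ys) → ∈-remove ys x∈ys z∈ys (x≢z ∘ sym)) (x∉xs , xs⊆ys)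

  length-filter-map : ∀ {A B : Set} {P : Pred B 0ℓ} (P? : Decidable P) (f : A → B) xs →
                      length (filter P? (map f xs)) ≡ length (filter (P? ∘ f) xs)
  length-filter-map P? f [] = refl
  length-filter-map P? f (x ∷ xs) with does (P? (f x))
  ... | true  = cong suc (length-filter-map P? f xs)
  ... | false = length-filter-map P? f xs

  length-filter-∷ : ∀ {A : Set} {P : Pred A 0ℓ} (P? : Decidable P) x xs →
                    length (filter P? (x ∷ xs)) ≡ (if does (P? x) then 1 else 0) + length (filter P? xs)
  length-filter-∷ P? x xs with does (P? x)
  ... | true  = refl
  ... | false = refl

  Unique-map-filter : ∀ {A B : Set} (f : A → B) {P : Pred A 0ℓ} (P? : Decidable P) xs →
                      Unique (map f xs) → Unique (map f (filter P? xs))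
  Unique-map-filter f P? []       _           = []
  Unique-map-filter f P? (x ∷ xs) (fx∉ ∷ u) with does (P? x)
  ... | true  = All.map⁺ (All.filter⁺ P? (All.map⁻ fx∉)) ∷ Unique-map-filter f P? xs u
  ... | false = Unique-map-filter f P? xs u

module FiniteSums where

  open import Data.Nat using (ℕ; zero; suc; _+_; _*_; _∸_; _^_; _≤_; _<_; z≤n; s≤s)
  open import Data.Nat.Properties hiding (_≟_; suc-injective)
  open import Data.Fin using (Fin; zero; suc)
  open import Data.Fin.Properties using (_≟_; suc-injective)
  open import Data.Bool using (if_then_else_)
  open import Data.Empty using (⊥-elim)
  open import Relation.Nullary using (does; yes; no)
  open import Relation.Binary.PropositionalEquality
  open import Function using (_∘_)
  open import Data.Vec.Functional using (removeAt)
  open import Data.Nat.Solver using (module +-*-Solver)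
  open +-*-Solver using (solve; _:*_; _:=_)
  open import Algebra.Properties.Semiring.Sum +-*-semiring public
    using (sum; sum-cong-≗; ∑-distrib-+; ∑-comm; sum-remove; *-distribˡ-sum; *-distribʳ-sum)
  open import Algebra.Properties.CommutativeMonoid.Sum *-1-commutativeMonoid public
    using () renaming (sum to product; sum-cong-≗ to product-cong-≗; ∑-distrib-+ to product-distrib-*; sum-replicate-zero to product-ones)

  sum-mono-≤ : ∀ {r} {f g : Fin r → ℕ} → (∀ i → f i ≤ g i) → sum f ≤ sum g
  sum-mono-≤ {zero}  f≤g = z≤n
  sum-mono-≤ {suc r} f≤g = +-mono-≤ (f≤g zero) (sum-mono-≤ (f≤g ∘ suc))

  product-mono-≤ : ∀ {r} {f g : Fin r → ℕ} → (∀ i → f i ≤ g i) → product f ≤ product g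
  product-mono-≤ {zero}  f≤g = ≤-refl
  product-mono-≤ {suc r} f≤g = *-mono-≤ (f≤g zero) (product-mono-≤ (f≤g ∘ suc))

  lookup≤sum : ∀ {r} (f : Fin r → ℕ) i → f i ≤ sum f
  lookup≤sum f zero    = m≤m+n _ _
  lookup≤sum f (suc i) = ≤-trans (lookup≤sum (f ∘ suc) i) (m≤n+m _ _)

  lookup<sum : ∀ {r} → 2 ≤ r → (f : Fin r → ℕ) → (∀ i → 1 ≤ f i) → ∀ i → f i < sum f
  lookup<sum (s≤s (s≤s _)) f 1≤f i = begin
    suc (f i)                       ≡⟨ +-comm 1 (f i) ⟩
    f i + 1                         ≤⟨ +-monoʳ-≤ (f i) (≤-trans (1≤f _) (lookup≤sum (removeAt f i) zero)) ⟩
    f i + sum (removeAt f i)        ≡⟨ sum-remove f ⟨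
    sum f                           ∎
    where open ≤-Reasoning

  sum-const : ∀ r x → sum {r} (λ _ → x) ≡ r * x
  sum-const zero    x = refl
  sum-const (suc r) x = cong (x +_) (sum-const r x)

  sum-zero : ∀ r → sum {r} (λ _ → 0) ≡ 0
  sum-zero r = trans (sum-const r 0) (*-zeroʳ r)

  ∑-distrib-∸ : ∀ {r} (f g : Fin r → ℕ) → (∀ i → g i ≤ f i) → sum (λ i → f i ∸ g i) ≡ sum f ∸ sum g
  ∑-distrib-∸ f g g≤f = begin
    sum (λ i → f i ∸ g i)                     ≡⟨ m+n∸n≡m _ (sum g) ⟨
    sum (λ i → f i ∸ g i) + sum g ∸ sum g     ≡⟨ cong (_∸ sum g) (∑-distrib-+ (λ i → f i ∸ g i) g) ⟨
    sum (λ i → f i ∸ g i + g i) ∸ sum g       ≡⟨ cong (_∸ sum g) (sum-cong-≗ (λ i → m∸n+n≡m (g≤f i))) ⟩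
    sum f ∸ sum g                             ∎
    where open ≡-Reasoning

  weighted-sum-bound : ∀ {r} x (w m : Fin r → ℕ) q Q → x ≤ sum (λ c → w c * m c) → (∀ c → m c * q ≤ Q) → x * q ≤ sum w * Q
  weighted-sum-bound x w m q Q x≤ mq≤Q = begin
    x * q                              ≤⟨ *-monoˡ-≤ q x≤ ⟩
    sum (λ c → w c * m c) * q          ≡⟨ *-distribʳ-sum q (λ c → w c * m c) ⟩
    sum (λ c → w c * m c * q)          ≡⟨ sum-cong-≗ (λ c → *-assoc (w c) (m c) q) ⟩
    sum (λ c → w c * (m c * q))        ≤⟨ sum-mono-≤ (λ c → *-monoʳ-≤ (w c) (mq≤Q c)) ⟩
    sum (λ c → w c * Q)                ≡⟨ *-distribʳ-sum Q w ⟨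
    sum w * Q                          ∎
    where open ≤-Reasoning

  product-zero : ∀ {r} (f : Fin r → ℕ) a → f a ≡ 0 → product f ≡ 0
  product-zero f zero    fa≡0 = cong (_* product (f ∘ suc)) fa≡0
  product-zero f (suc a) fa≡0 = trans (cong (f zero *_) (product-zero (f ∘ suc) a fa≡0)) (*-zeroʳ (f zero))

  product-pos : ∀ {r} (f : Fin r → ℕ) → (∀ i → 0 < f i) → 0 < product f
  product-pos {zero}  f f>0 = s≤s z≤n
  product-pos {suc r} f f>0 = *-mono-< (f>0 zero) (product-pos (f ∘ suc) (f>0 ∘ suc))

  ^-sum : ∀ {r} c (u : Fin r → ℕ) → c ^ sum u ≡ product (λ i → c ^ u i)
  ^-sum {zero}  c u = refl
  ^-sum {suc r} c u = trans (^-distribˡ-+-* c (u zero) (sum (u ∘ suc))) (cong (c ^ u zero *_) (^-sum c (u ∘ suc)))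

  ^-distribʳ-* : ∀ a b u → (a * b) ^ u ≡ a ^ u * b ^ u
  ^-distribʳ-* a b zero    = refl
  ^-distribʳ-* a b (suc u) rewrite ^-distribʳ-* a b u =
    solve 4 (λ a b x y → a :* b :* (x :* y) := a :* x :* (b :* y)) refl a b (a ^ u) (b ^ u)

  product-additiveAt : ∀ {r} (a : Fin r) (g g₁ g₂ : Fin r → ℕ) →
                       (∀ {i} → a ≢ i → g i ≡ g₁ i) → (∀ {i} → a ≢ i → g i ≡ g₂ i) →
                       g a ≡ g₁ a + g₂ a → product g ≡ product g₁ + product g₂
  product-additiveAt zero g g₁ g₂ g≡g₁ g≡g₂ ga = begin
    g zero * product (g ∘ suc)                                ≡⟨ cong₂ _*_ ga (product-cong-≗ (λ i → g≡g₁ {suc i} (λ ()))) ⟩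
    (g₁ zero + g₂ zero) * product (g₁ ∘ suc)                  ≡⟨ *-distribʳ-+ _ (g₁ zero) (g₂ zero) ⟩
    g₁ zero * product (g₁ ∘ suc) + g₂ zero * product (g₁ ∘ suc)
        ≡⟨ cong (λ x → _ + g₂ zero * x) (product-cong-≗ (λ i → trans (sym (g≡g₁ {suc i} (λ ()))) (g≡g₂ (λ ())))) ⟩
    g₁ zero * product (g₁ ∘ suc) + g₂ zero * product (g₂ ∘ suc) ∎
    where open ≡-Reasoning
  product-additiveAt (suc a) g g₁ g₂ g≡g₁ g≡g₂ ga = begin
    g zero * product (g ∘ suc)
        ≡⟨ cong (g zero *_) (product-additiveAt a (g ∘ suc) (g₁ ∘ suc) (g₂ ∘ suc)
                               (λ a≢i → g≡g₁ (a≢i ∘ suc-injective)) (λ a≢i → g≡g₂ (a≢i ∘ suc-injective)) ga) ⟩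
    g zero * (product (g₁ ∘ suc) + product (g₂ ∘ suc))          ≡⟨ *-distribˡ-+ (g zero) _ _ ⟩
    g zero * product (g₁ ∘ suc) + g zero * product (g₂ ∘ suc)   ≡⟨ cong₂ (λ x y → x * _ + y * _) (g≡g₁ {zero} (λ ())) (g≡g₂ {zero} (λ ())) ⟩
    g₁ zero * product (g₁ ∘ suc) + g₂ zero * product (g₂ ∘ suc) ∎
    where open ≡-Reasoning

  δ : ∀ {r} → Fin r → Fin r → ℕ
  δ a i = if does (a ≟ i) then 1 else 0

  δ-refl : ∀ {r} (a : Fin r) → δ a a ≡ 1
  δ-refl a with a ≟ a
  ... | yes _   = refl
  ... | no a≢a = ⊥-elim (a≢a refl)

  δ-≢ : ∀ {r} {a i : Fin r} → a ≢ i → δ a i ≡ 0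
  δ-≢ {a = a} {i} a≢i with a ≟ i
  ... | yes a≡i = ⊥-elim (a≢i a≡i)
  ... | no _    = refl

  δ-sym : ∀ {r} (a i : Fin r) → δ a i ≡ δ i a
  δ-sym a i with a ≟ i | i ≟ a
  ... | yes _   | yes _   = refl
  ... | yes a≡i | no i≢a = ⊥-elim (i≢a (sym a≡i))
  ... | no a≢i | yes i≡a = ⊥-elim (a≢i (sym i≡a))
  ... | no _    | no _    = refl

  δ-≤ : ∀ {r} (a : Fin r) (s : Fin r → ℕ) → 1 ≤ s a → ∀ i → δ a i ≤ s i
  δ-≤ a s 1≤sa i with a ≟ i
  ... | yes refl = 1≤sa
  ... | no _     = z≤n

  δ+[∸δ] : ∀ {r} (a : Fin r) (s : Fin r → ℕ) → 1 ≤ s a → ∀ i → δ a i + (s i ∸ δ a i) ≡ s i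
  δ+[∸δ] a s 1≤sa i = m+[n∸m]≡n (δ-≤ a s 1≤sa i)

  sum-δ* : ∀ {r} (a : Fin r) (g : Fin r → ℕ) → sum (λ i → δ a i * g i) ≡ g a
  sum-δ* {suc r} zero    g = trans (cong (g zero + 0 +_) (sum-zero r)) (trans (+-identityʳ _) (+-identityʳ _))
  sum-δ* {suc r} (suc a) g = sum-δ* a (g ∘ suc)

  sum-δ : ∀ {r} (a : Fin r) → sum (δ a) ≡ 1
  sum-δ a = trans (sum-cong-≗ (λ i → sym (*-identityʳ (δ a i)))) (sum-δ* a (λ _ → 1))

module Binomials where

  open import Data.Nat using (ℕ; zero; suc; _+_; _*_; _∸_; _^_; _!; _≤_; _<_; z≤n; s≤s)
  open import Data.Nat.Properties
  open import Data.Nat.Combinatorics using (_C_; nC1≡n; nCk+nC[k+1]≡[n+1]C[k+1])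
  open import Relation.Binary.PropositionalEquality

  pascal : ∀ n k → suc n C suc k ≡ n C k + n C suc k
  pascal n k = sym (nCk+nC[k+1]≡[n+1]C[k+1] n k)

  C-absorb : ∀ n k → (suc n C suc k) * suc k ≡ suc n * (n C k)
  C-absorb zero    zero    = refl
  C-absorb zero    (suc k) = refl
  C-absorb (suc n) zero    = trans (*-identityʳ (suc (suc n) C 1)) (trans (nC1≡n (suc (suc n))) (sym (*-identityʳ (suc (suc n)))))
  C-absorb (suc n) (suc k) = begin
    (suc (suc n) C suc (suc k)) * suc (suc k)          ≡⟨ cong (_* suc (suc k)) (pascal (suc n) (suc k)) ⟩
    (A + A′) * suc (suc k)                              ≡⟨ *-distribʳ-+ (suc (suc k)) A A′ ⟩
    A * suc (suc k) + A′ * suc (suc k)                  ≡⟨ cong₂ _+_ (*-suc A (suc k)) (C-absorb n (suc k)) ⟩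
    A + A * suc k + suc n * (n C suc k)                 ≡⟨ cong (λ x → A + x + suc n * (n C suc k)) (C-absorb n k) ⟩
    A + suc n * (n C k) + suc n * (n C suc k)           ≡⟨ +-assoc A _ _ ⟩
    A + (suc n * (n C k) + suc n * (n C suc k))         ≡⟨ cong (A +_) (*-distribˡ-+ (suc n) (n C k) (n C suc k)) ⟨
    A + suc n * ((n C k) + (n C suc k))                 ≡⟨ cong (λ x → A + suc n * x) (pascal n k) ⟨
    suc (suc n) * A                                     ∎
    where
    open ≡-Reasoning
    A  = suc n C suc k
    A′ = suc n C suc (suc k)

  C*!≤^ : ∀ f u → (f C u) * u ! ≤ f ^ u
  C*!≤^ f       zero    = ≤-refl
  C*!≤^ zero    (suc u) = z≤n
  C*!≤^ (suc f) (suc u) = begin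
    (suc f C suc u) * (suc u * u !)  ≡⟨ *-assoc (suc f C suc u) (suc u) (u !) ⟨
    (suc f C suc u) * suc u * u !    ≡⟨ cong (_* u !) (C-absorb f u) ⟩
    suc f * (f C u) * u !            ≡⟨ *-assoc (suc f) (f C u) (u !) ⟩
    suc f * ((f C u) * u !)          ≤⟨ *-monoʳ-≤ (suc f) (≤-trans (C*!≤^ f u) (^-monoˡ-≤ u (n≤1+n f))) ⟩
    suc f * suc f ^ u                ∎
    where open ≤-Reasoning

  ∸^≤C*! : ∀ f u → (f ∸ u) ^ u ≤ (f C u) * u !
  ∸^≤C*! f       zero    = ≤-refl
  ∸^≤C*! zero    (suc u) = z≤n
  ∸^≤C*! (suc f) (suc u) = begin
    (f ∸ u) * (f ∸ u) ^ u            ≤⟨ *-mono-≤ (≤-trans (m∸n≤m f u) (n≤1+n f)) (∸^≤C*! f u) ⟩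
    suc f * ((f C u) * u !)          ≡⟨ *-assoc (suc f) (f C u) (u !) ⟨
    suc f * (f C u) * u !            ≡⟨ cong (_* u !) (C-absorb f u) ⟨
    (suc f C suc u) * suc u * u !    ≡⟨ *-assoc (suc f C suc u) (suc u) (u !) ⟩
    (suc f C suc u) * (suc u * u !)  ∎
    where open ≤-Reasoning

  infix 8 _C[_-_]

  -- C(f, t − s) if s ≤ t, and 0 (rather than the truncated-subtraction value C(f, 0)) if t < s
  _C[_-_] : ℕ → ℕ → ℕ → ℕ
  f C[ t     - zero  ] = f C t
  f C[ zero  - suc s ] = 0
  f C[ suc t - suc s ] = f C[ t - s ]

  C[-]-≤ : ∀ f {t s} → s ≤ t → f C[ t - s ] ≡ f C (t ∸ s)
  C[-]-≤ f {s = zero}  _         = refl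
  C[-]-≤ f {s = suc s} (s≤s s≤t) = C[-]-≤ f s≤t

  C[-]-> : ∀ f {t s} → t < s → f C[ t - s ] ≡ 0
  C[-]-> f {zero}  {suc s} _         = refl
  C[-]-> f {suc t} {suc s} (s≤s t<s) = C[-]-> f t<s

  C[-]-pascal : ∀ f t s → suc f C[ suc t - s ] ≡ f C[ t - s ] + f C[ suc t - s ]
  C[-]-pascal f t       zero          = pascal f t
  C[-]-pascal f zero    (suc zero)    = refl
  C[-]-pascal f zero    (suc (suc s)) = refl
  C[-]-pascal f (suc t) (suc s)       = C[-]-pascal f t s

  C[0-] : ∀ f s → suc f C[ 0 - s ] ≡ f C[ 0 - s ]
  C[0-] f zero    = refl
  C[0-] f (suc s) = refl

  C[-]-suc : ∀ f {u} s → 1 ≤ u → f C[ u ∸ 1 - s ] ≡ f C[ u - suc s ]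
  C[-]-suc f s (s≤s _) = refl

module PartitionTypes where

  open FiniteSums
  open import Data.Nat using (ℕ; zero; suc; _+_; _∸_; _≤_; z≤n; s≤s)
  open import Data.Nat.Properties hiding (_≟_)
  open import Data.Fin using (Fin; zero; suc)
  open import Data.Fin.Properties using (_≟_; any?)
  open import Data.Fin.Subset using (Subset; ∣_∣; _∩_; _⊆_; ∁; ⊤; _∈_; inside; outside)
  open import Data.Fin.Subset.Properties using (∩-identityˡ; ∣⊤∣≡n; ∣⊥∣≡0; Empty-unique; x∈p∩q⁻; x∈p∩q⁺; x∈∁p⇒x∉p; p⊆q⇒∣p∣≤∣q∣; p∩q⊆q)
  open import Data.List using (List; []; _∷_; map)
  import Data.Nat.ListAction as List
  open import Data.List.Relation.Unary.Any using (Any; here; there)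
  open import Data.Vec using ([]; _∷_)
  open import Data.Product using (Σ; ∃; _,_)
  open import Relation.Nullary using (¬_; yes; no)
  open import Relation.Binary.PropositionalEquality
  open import Data.Empty using (⊥-elim)
  open import Function using (_∘_)

  type : ∀ {n r} → (Fin n → Fin r) → Subset n → Fin r → ℕ
  type p T i = ∣ T ∩ part p i ∣

  part-cons : ∀ {n r} (p : Fin (suc n) → Fin r) i → ∣ part p i ∣ ≡ δ (p zero) i + ∣ part (p ∘ suc) i ∣
  part-cons p i with p zero ≟ i
  ... | yes _ = refl
  ... | no _  = refl

  type-inside : ∀ {n r} (p : Fin (suc n) → Fin r) T i → type p (inside ∷ T) i ≡ δ (p zero) i + type (p ∘ suc) T i
  type-inside p T i with p zero ≟ i
  ... | yes _ = refl
  ... | no _  = refl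

  sum-type : ∀ {n r} (p : Fin n → Fin r) T → sum (type p T) ≡ ∣ T ∣
  sum-type {zero}  {r} p []             = sum-zero r
  sum-type {suc n}     p (outside ∷ T) = sum-type (p ∘ suc) T
  sum-type {suc n}     p (inside ∷ T)  = begin
    sum (type p (inside ∷ T))                          ≡⟨ sum-cong-≗ (type-inside p T) ⟩
    sum (λ i → δ (p zero) i + type (p ∘ suc) T i)      ≡⟨ ∑-distrib-+ (δ (p zero)) (type (p ∘ suc) T) ⟩
    sum (δ (p zero)) + sum (type (p ∘ suc) T)          ≡⟨ cong₂ _+_ (sum-δ (p zero)) (sum-type (p ∘ suc) T) ⟩
    suc ∣ T ∣                                          ∎
    where open ≡-Reasoning

  sum-part : ∀ {n r} (p : Fin n → Fin r) → sum (λ i → ∣ part p i ∣) ≡ n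
  sum-part {n} p = trans (sum-cong-≗ (λ i → cong ∣_∣ (sym (∩-identityˡ (part p i))))) (trans (sum-type p ⊤) (∣⊤∣≡n n))

  ∣p∩q∣+∣∁p∩q∣≡∣q∣ : ∀ {n} (p q : Subset n) → ∣ p ∩ q ∣ + ∣ ∁ p ∩ q ∣ ≡ ∣ q ∣
  ∣p∩q∣+∣∁p∩q∣≡∣q∣ []            []            = refl
  ∣p∩q∣+∣∁p∩q∣≡∣q∣ (inside ∷ p)  (inside ∷ q)  = cong suc (∣p∩q∣+∣∁p∩q∣≡∣q∣ p q)
  ∣p∩q∣+∣∁p∩q∣≡∣q∣ (inside ∷ p)  (outside ∷ q) = ∣p∩q∣+∣∁p∩q∣≡∣q∣ p q
  ∣p∩q∣+∣∁p∩q∣≡∣q∣ (outside ∷ p) (inside ∷ q)  = trans (+-suc _ _) (cong suc (∣p∩q∣+∣∁p∩q∣≡∣q∣ p q))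
  ∣p∩q∣+∣∁p∩q∣≡∣q∣ (outside ∷ p) (outside ∷ q) = ∣p∩q∣+∣∁p∩q∣≡∣q∣ p q

  type+free : ∀ {n r} (p : Fin n → Fin r) S i → type p S i + type p (∁ S) i ≡ ∣ part p i ∣
  type+free p S i = ∣p∩q∣+∣∁p∩q∣≡∣q∣ S (part p i)

  subsetOfType : ∀ {n r} (p : Fin n → Fin r) (s : Fin r → ℕ) → (∀ i → s i ≤ ∣ part p i ∣) → ∃ λ S → type p S ≗ s
  subsetOfType {zero}  p s s≤ = [] , λ i → sym (n≤0⇒n≡0 (s≤ i))
  subsetOfType {suc n} p s s≤ with s (p zero) in eq
  ... | zero  = let (S , hS) = subsetOfType (p ∘ suc) s s≤′ in outside ∷ S , hS
    where
    s≤′ : ∀ i → s i ≤ ∣ part (p ∘ suc) i ∣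
    s≤′ i with p zero ≟ i | s≤ i
    ... | yes refl | _    = ≤-trans (≤-reflexive eq) z≤n
    ... | no _     | s≤pi = s≤pi
  ... | suc _ = let (S , hS) = subsetOfType (p ∘ suc) (λ i → s i ∸ δ (p zero) i) s≤′ in
                inside ∷ S , λ i → trans (type-inside p S i) (trans (cong (δ (p zero) i +_) (hS i)) (δ+[∸δ] (p zero) s 1≤sa i))
    where
    1≤sa : 1 ≤ s (p zero)
    1≤sa = ≤-trans (s≤s z≤n) (≤-reflexive (sym eq))
    s≤′ : ∀ i → s i ∸ δ (p zero) i ≤ ∣ part (p ∘ suc) i ∣
    s≤′ i = ≤-trans (∸-monoˡ-≤ (δ (p zero) i) (s≤ i)) (≤-reflexive (trans (cong (_∸ δ (p zero) i) (part-cons p i)) (m+n∸m≡n (δ (p zero) i) _)))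

  partitionOfSizes : ∀ {r} (c : Fin r → ℕ) N → sum c ≡ N → Σ (Fin N → Fin r) λ p → ∀ i → ∣ part p i ∣ ≡ c i
  partitionOfSizes c zero    Σc≡0 = (λ ()) , λ i → sym (n≤0⇒n≡0 (≤-trans (lookup≤sum c i) (≤-reflexive Σc≡0)))
  partitionOfSizes {r} c (suc N) Σc≡N+1 with any? (λ i → 1 ≤? c i)
  ... | no ∄i = ⊥-elim (0≢1+n (trans (sym (sum-zero r)) (trans (sum-cong-≗ (λ i → sym (n≤0⇒n≡0 (≮⇒≥ (λ 0<ci → ∄i (i , 0<ci)))))) Σc≡N+1)))
  ... | yes (a , 1≤ca) = let (p , hp) = partitionOfSizes c′ N Σc′≡N in
                         p′ p , λ i → trans (part-cons (p′ p) i) (trans (cong (δ a i +_) (hp i)) (δ+[∸δ] a c 1≤ca i))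
    where
    c′ : Fin r → ℕ
    c′ i = c i ∸ δ a i
    Σc′≡N : sum c′ ≡ N
    Σc′≡N = trans (∑-distrib-∸ c (δ a) (δ-≤ a c 1≤ca)) (cong₂ _∸_ Σc≡N+1 (sum-δ a))
    p′ : (Fin N → Fin r) → Fin (suc N) → Fin r
    p′ p zero    = a
    p′ p (suc v) = p v

  ∣p∣≤sum-∣q∩p∣ : ∀ {n} {X : Set} (q : X → Subset n) (xs : List X) (p : Subset n) →
                   (∀ {v} → v ∈ p → Any (λ x → v ∈ q x) xs) → ∣ p ∣ ≤ List.sum (map (λ x → ∣ q x ∩ p ∣) xs)
  ∣p∣≤sum-∣q∩p∣ {n} q []       p covered = ≤-reflexive (trans (cong ∣_∣ (Empty-unique λ (v , v∈p) → uncovered (covered v∈p))) (∣⊥∣≡0 n))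
    where
    uncovered : ∀ {v} → ¬ Any (λ x → v ∈ q x) []
    uncovered ()
  ∣p∣≤sum-∣q∩p∣ q (x ∷ xs) p covered = begin
    ∣ p ∣                                                      ≡⟨ ∣p∩q∣+∣∁p∩q∣≡∣q∣ (q x) p ⟨
    ∣ q x ∩ p ∣ + ∣ ∁ (q x) ∩ p ∣                              ≤⟨ +-monoʳ-≤ ∣ q x ∩ p ∣ (∣p∣≤sum-∣q∩p∣ q xs _ covered′) ⟩
    ∣ q x ∩ p ∣ + List.sum (map (λ y → ∣ q y ∩ (∁ (q x) ∩ p) ∣) xs) ≤⟨ +-monoʳ-≤ ∣ q x ∩ p ∣ (shrink xs) ⟩
    ∣ q x ∩ p ∣ + List.sum (map (λ y → ∣ q y ∩ p ∣) xs)        ∎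
    where
    open ≤-Reasoning
    covered′ : ∀ {v} → v ∈ ∁ (q x) ∩ p → Any (λ y → v ∈ q y) xs
    covered′ v∈ with x∈p∩q⁻ (∁ (q x)) p v∈
    ... | v∉qx , v∈p with covered v∈p
    ... | here v∈qx = ⊥-elim (x∈∁p⇒x∉p v∉qx v∈qx)
    ... | there any = any
    shrink : ∀ ys → List.sum (map (λ y → ∣ q y ∩ (∁ (q x) ∩ p) ∣) ys) ≤ List.sum (map (λ y → ∣ q y ∩ p ∣) ys)
    shrink []       = z≤n
    shrink (y ∷ ys) = +-mono-≤ (p⊆q⇒∣p∣≤∣q∣ q∩rest⊆q∩p) (shrink ys)
      where
      q∩rest⊆q∩p : q y ∩ (∁ (q x) ∩ p) ⊆ q y ∩ p
      q∩rest⊆q∩p v∈ = let (v∈qy , v∈rest) = x∈p∩q⁻ (q y) _ v∈ in x∈p∩q⁺ (v∈qy , p∩q⊆q (∁ (q x)) p v∈rest)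

module Extensions where

  open FiniteSums
  open Binomials
  open PartitionTypes
  open Filtering
  open import Data.Nat using (ℕ; zero; suc; _+_; _∸_; _≤_; z≤n; s≤s)
  open import Data.Nat.Properties hiding (_≟_)
  open import Data.Fin using (Fin; zero; suc)
  open import Data.Bool using (Bool)
  open import Data.Fin.Properties using (_≟_; all?; ¬∀⟶∃¬)
  open import Data.Fin.Subset using (Subset; ∁; _⊆_; inside; outside) renaming (_∈_ to _∈ₛ_)
  open import Data.Fin.Subset.Properties using (_⊆?_; drop-∷-⊆; out⊆; in⊆in)
  open import Data.Vec using ([]; _∷_; here)
  open import Data.List using (List; []; _∷_; _++_; map; filter; length)
  open import Data.List.Membership.Propositional using (_∈_)
  open import Data.List.Membership.Propositional.Properties using (∈-map⁺; ∈-map⁻; ∈-++⁺ˡ; ∈-++⁺ʳ)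
  open import Data.List.Relation.Unary.Any using (here)
  open import Data.List.Properties using (filter-accept; filter-reject)
  open import Data.Nat.Combinatorics using (_C_)
  open import Data.List.Relation.Unary.Unique.Propositional using (Unique; []; _∷_)
  import Data.List.Relation.Unary.Unique.Propositional.Properties as Unique
  import Data.List.Relation.Unary.All as All
  open import Data.Product using (_×_; _,_; proj₁; proj₂)
  open import Relation.Nullary using (¬_; Dec; yes; no)
  open import Relation.Nullary.Decidable using (_×-dec_)
  open import Relation.Binary.PropositionalEquality
  open import Data.Empty using (⊥-elim)
  open import Function using (_∘_)

  allSubsets : ∀ n → List (Subset n)
  allSubsets zero    = [] ∷ []
  allSubsets (suc n) = map (inside ∷_) (allSubsets n) ++ map (outside ∷_) (allSubsets n)

  ∈-allSubsets : ∀ {n} (T : Subset n) → T ∈ allSubsets n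
  ∈-allSubsets []                    = here refl
  ∈-allSubsets (inside ∷ T)          = ∈-++⁺ˡ (∈-map⁺ (inside ∷_) (∈-allSubsets T))
  ∈-allSubsets {suc n} (outside ∷ T) = ∈-++⁺ʳ (map (inside ∷_) (allSubsets n)) (∈-map⁺ (outside ∷_) (∈-allSubsets T))

  allSubsets-unique : ∀ n → Unique (allSubsets n)
  allSubsets-unique zero    = All.[] ∷ []
  allSubsets-unique (suc n) = Unique.++⁺ (Unique.map⁺ ∷-injectiveʳ (allSubsets-unique n)) (Unique.map⁺ ∷-injectiveʳ (allSubsets-unique n)) disjoint
    where
    ∷-injectiveʳ : ∀ {b} {x y : Subset n} → (b ∷ x) ≡ (b ∷ y) → x ≡ y
    ∷-injectiveʳ refl = refl
    disjoint : ∀ {T} → ¬ (T ∈ map (inside ∷_) (allSubsets n) × T ∈ map (outside ∷_) (allSubsets n))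
    disjoint (T∈in , T∈out) with ∈-map⁻ (inside ∷_) T∈in | ∈-map⁻ (outside ∷_) T∈out
    ... | _ , _ , refl | _ , _ , ()

  ExtensionOfType : ∀ {n r} → (Fin n → Fin r) → Subset n → (Fin r → ℕ) → Subset n → Set
  ExtensionOfType p S t T = S ⊆ T × type p T ≗ t

  extensionOfType? : ∀ {n r} (p : Fin n → Fin r) S t T → Dec (ExtensionOfType p S t T)
  extensionOfType? p S t T = (S ⊆? T) ×-dec all? (λ i → type p T i Data.Nat.≟ t i)

  extensions : ∀ {n r} → (Fin n → Fin r) → Subset n → (Fin r → ℕ) → ℕ
  extensions {n} p S t = length (filter (extensionOfType? p S t) (allSubsets n))

  ∷⊆inside∷ : ∀ {n} y {U V : Subset n} → U ⊆ V → (y ∷ U) ⊆ (inside ∷ V)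
  ∷⊆inside∷ inside  = in⊆in
  ∷⊆inside∷ outside = out⊆

  extensionProduct : ∀ {n r} → (Fin n → Fin r) → Subset n → (Fin r → ℕ) → ℕ
  extensionProduct p S t = product (λ i → type p (∁ S) i C[ t i - type p S i ])

  extensions-empty : ∀ {r} (p : Fin 0 → Fin r) t → extensions p [] t ≡ extensionProduct p [] t
  extensions-empty {r} p t with extensionOfType? p [] t []
  ... | yes e@(_ , t≗0) = trans (cong length (filter-accept (extensionOfType? p [] t) e))
                                (sym (trans (product-cong-≗ (λ i → cong (0 C_) (sym (t≗0 i)))) (product-ones r)))
  ... | no ¬e = trans (cong length (filter-reject (extensionOfType? p [] t) ¬e)) (sym (product-zero _ i (0C-pos ti≢0)))
    where
    ∃t≢0 = ¬∀⟶∃¬ _ (λ i → 0 ≡ t i) (λ i → 0 Data.Nat.≟ t i) (λ t≗0 → ¬e ((λ ()) , t≗0))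
    i = proj₁ ∃t≢0
    ti≢0 = proj₂ ∃t≢0
    0C-pos : ∀ {x} → 0 ≢ x → 0 C x ≡ 0
    0C-pos {zero}  0≢0 = ⊥-elim (0≢0 refl)
    0C-pos {suc x} _   = refl

  private
    module Step {n r} (p : Fin (suc n) → Fin r) (t : Fin r → ℕ) (S : Subset n) where

      a  = p zero
      p′ = p ∘ suc
      t′ : Fin r → ℕ
      t′ i = t i ∸ δ a i

      withHead : Bool → Subset (suc n) → ℕ
      withHead x S = length (filter (extensionOfType? p S t ∘ (x ∷_)) (allSubsets n))

      split : ∀ y → extensions p (y ∷ S) t ≡ withHead inside (y ∷ S) + withHead outside (y ∷ S)
      split y = trans (length-filter-++ (extensionOfType? p (y ∷ S) t) (map (inside ∷_) (allSubsets n)) _)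
                      (cong₂ _+_ (length-filter-map _ (inside ∷_) (allSubsets n)) (length-filter-map _ (outside ∷_) (allSubsets n)))

      withInside-pos : ∀ y → 1 ≤ t a → withHead inside (y ∷ S) ≡ extensions p′ S t′
      withInside-pos y 1≤ta = length-filter-cong _ _
        (λ {T} (S⊆T , hT) → drop-∷-⊆ S⊆T , λ i → trans (sym (m+n∸m≡n (δ a i) _)) (cong (_∸ δ a i) (trans (sym (type-inside p T i)) (hT i))))
        (λ {T} (S⊆T , hT) → ∷⊆inside∷ y S⊆T , λ i → trans (type-inside p T i) (trans (cong (δ a i +_) (hT i)) (δ+[∸δ] a t 1≤ta i)))
        (allSubsets n)

      withInside-zero : ∀ y → t a ≡ 0 → withHead inside (y ∷ S) ≡ 0
      withInside-zero y ta≡0 = length-filter-none _ (λ {T} (_ , hT) → 1+n≢0 (begin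
        suc (type p′ T a)       ≡⟨ cong (_+ type p′ T a) (δ-refl a) ⟨
        δ a a + type p′ T a     ≡⟨ type-inside p T a ⟨
        type p (inside ∷ T) a   ≡⟨ hT a ⟩
        t a                     ≡⟨ ta≡0 ⟩
        0                       ∎)) (allSubsets n)
        where open ≡-Reasoning

      withOutside-inside : withHead outside (inside ∷ S) ≡ 0
      withOutside-inside = length-filter-none _ (λ (S⊆T , _) → zero∉outside∷ (S⊆T here)) (allSubsets n)
        where
        zero∉outside∷ : ∀ {T : Subset n} → ¬ (zero ∈ₛ (outside ∷ T))
        zero∉outside∷ ()

      withOutside-outside : withHead outside (outside ∷ S) ≡ extensions p′ S t
      withOutside-outside = length-filter-cong _ _ (λ (S⊆T , hT) → drop-∷-⊆ S⊆T , hT) (λ (S⊆T , hT) → out⊆ S⊆T , hT) (allSubsets n)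

      TailFormula = ∀ t → extensions p′ S t ≡ extensionProduct p′ S t

      inside-zero : t a ≡ 0 → extensions p (inside ∷ S) t ≡ extensionProduct p (inside ∷ S) t
      inside-zero ta≡0 = trans (split inside) (trans (cong₂ _+_ (withInside-zero inside ta≡0) withOutside-inside)
                                                     (sym (product-zero _ a ga≡0)))
        where
        ga≡0 : type p′ (∁ S) a C[ t a - type p (inside ∷ S) a ] ≡ 0
        ga≡0 = cong₂ (λ u v → type p′ (∁ S) a C[ u - v ]) ta≡0 (trans (type-inside p S a) (cong (_+ type p′ S a) (δ-refl a)))

      inside-pos : 1 ≤ t a → TailFormula → extensions p (inside ∷ S) t ≡ extensionProduct p (inside ∷ S) t
      inside-pos 1≤ta ih = begin
        extensions p (inside ∷ S) t                          ≡⟨ split inside ⟩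
        withHead inside (inside ∷ S) + withHead outside (inside ∷ S) ≡⟨ cong₂ _+_ (withInside-pos inside 1≤ta) withOutside-inside ⟩
        extensions p′ S t′ + 0                               ≡⟨ +-identityʳ _ ⟩
        extensions p′ S t′                                   ≡⟨ ih t′ ⟩
        extensionProduct p′ S t′                             ≡⟨ product-cong-≗ factor ⟩
        extensionProduct p (inside ∷ S) t                    ∎
        where
        open ≡-Reasoning
        factor : ∀ i → type p′ (∁ S) i C[ t i ∸ δ a i - type p′ S i ] ≡ type p (∁ (inside ∷ S)) i C[ t i - type p (inside ∷ S) i ]
        factor i rewrite type-inside p S i with a ≟ i
        ... | yes refl = C[-]-suc _ _ 1≤ta
        ... | no _     = refl

      outside-zero : t a ≡ 0 → TailFormula → extensions p (outside ∷ S) t ≡ extensionProduct p (outside ∷ S) t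
      outside-zero ta≡0 ih = begin
        extensions p (outside ∷ S) t                         ≡⟨ split outside ⟩
        withHead inside (outside ∷ S) + withHead outside (outside ∷ S) ≡⟨ cong₂ _+_ (withInside-zero outside ta≡0) withOutside-outside ⟩
        extensions p′ S t                                    ≡⟨ ih t ⟩
        extensionProduct p′ S t                              ≡⟨ product-cong-≗ factor ⟩
        extensionProduct p (outside ∷ S) t                   ∎
        where
        open ≡-Reasoning
        factor : ∀ i → type p′ (∁ S) i C[ t i - type p′ S i ] ≡ type p (∁ (outside ∷ S)) i C[ t i - type p (outside ∷ S) i ]
        factor i rewrite type-inside p (∁ S) i with a ≟ i
        ... | yes refl = trans (cong (λ u → f C[ u - s ]) ta≡0) (trans (sym (C[0-] f s)) (cong (λ u → suc f C[ u - s ]) (sym ta≡0)))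
          where
          f = type p′ (∁ S) a
          s = type p′ S a
        ... | no _     = refl

      outside-pos : ∀ {t₀} → t a ≡ suc t₀ → TailFormula → extensions p (outside ∷ S) t ≡ extensionProduct p (outside ∷ S) t
      outside-pos {t₀} ta≡ ih = begin
        extensions p (outside ∷ S) t                         ≡⟨ split outside ⟩
        withHead inside (outside ∷ S) + withHead outside (outside ∷ S) ≡⟨ cong₂ _+_ (withInside-pos outside 1≤ta) withOutside-outside ⟩
        extensions p′ S t′ + extensions p′ S t               ≡⟨ cong₂ _+_ (ih t′) (ih t) ⟩
        extensionProduct p′ S t′ + extensionProduct p′ S t
            ≡⟨ product-additiveAt a g (λ i → f i C[ t′ i - s i ]) (λ i → f i C[ t i - s i ]) g≡g₁ g≡g₂ ga ⟨
        extensionProduct p (outside ∷ S) t                   ∎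
        where
        open ≡-Reasoning
        1≤ta : 1 ≤ t a
        1≤ta = subst (1 ≤_) (sym ta≡) (s≤s z≤n)
        f s g : Fin r → ℕ
        f i = type p′ (∁ S) i
        s i = type p′ S i
        g i = type p (∁ (outside ∷ S)) i C[ t i - s i ]
        g≡g₂ : ∀ {i} → a ≢ i → g i ≡ f i C[ t i - s i ]
        g≡g₂ {i} a≢i rewrite type-inside p (∁ S) i | δ-≢ a≢i = refl
        g≡g₁ : ∀ {i} → a ≢ i → g i ≡ f i C[ t′ i - s i ]
        g≡g₁ {i} a≢i = trans (g≡g₂ a≢i) (cong (λ v → f i C[ t i ∸ v - s i ]) (sym (δ-≢ a≢i)))
        ga : g a ≡ f a C[ t′ a - s a ] + f a C[ t a - s a ]
        ga rewrite type-inside p (∁ S) a | δ-refl a | ta≡ = C[-]-pascal (f a) t₀ (s a)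

  extensions-formula : ∀ {n r} (p : Fin n → Fin r) S t → extensions p S t ≡ extensionProduct p S t
  extensions-formula {zero}  p []            t = extensions-empty p t
  extensions-formula {suc n} p (inside ∷ S)  t with t (p zero) in ta≡
  ... | zero  = Step.inside-zero p t S ta≡
  ... | suc _ = Step.inside-pos p t S (subst (1 ≤_) (sym ta≡) (s≤s z≤n)) (extensions-formula (p ∘ suc) S)
  extensions-formula {suc n} p (outside ∷ S) t with t (p zero) in ta≡
  ... | zero  = Step.outside-zero p t S ta≡ (extensions-formula (p ∘ suc) S)
  ... | suc _ = Step.outside-pos p t S ta≡ (extensions-formula (p ∘ suc) S)

module ValidTypes where

  open FiniteSums
  open import Data.Nat using (ℕ; zero; suc; _+_; _*_; _∸_; _≤_; z≤n; s≤s; NonZero; >-nonZero)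
  open import Data.Nat.Properties hiding (_≟_; suc-injective)
  open import Data.Fin using (Fin; zero; suc)
  open import Data.Fin.Properties using (_≟_)
  open import Data.Bool using (if_then_else_)
  open import Data.List using (tabulate)
  import Data.Nat.ListAction as List
  open import Data.Integer as ℤ using (ℤ; +_; -[1+_])
  import Data.Integer.Properties as ℤ
  open import Data.Product using (_,_)
  open import Data.Sum using (inj₁; inj₂)
  open import Relation.Nullary using (Dec; does; yes; no)
  open import Relation.Nullary.Decidable using (⌊_⌋)
  open import Relation.Binary.PropositionalEquality
  open import Data.Empty using (⊥-elim)
  open import Function using (_∘_)

  record EdgeTypes (k r : ℕ) (j : Fin r → ℕ) (σ : ℤ) : Set where
    field
      edgeType           : Fin r → Fin r → ℕ
      edgeType-shifted   : ∀ c i → + edgeType c i ≡ shifted j σ c i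
      edgeType-size      : ∀ c → sum (edgeType c) ≡ k
      edgeType-injective : ∀ c c′ → edgeType c ≗ edgeType c′ → c ≡ c′
      weight-int         : ∀ i → + sum (λ c → edgeType c i) ≡ + (r * j i) ℤ.+ σ
      weight-pos         : ∀ i → 1 ≤ sum (λ c → edgeType c i)

    weight : Fin r → ℕ
    weight i = sum (λ c → edgeType c i)

    sum-weight : sum weight ≡ r * k
    sum-weight = trans (∑-comm (λ i c → edgeType c i)) (trans (sum-cong-≗ edgeType-size) (sum-const r k))

  sum-tabulate : ∀ {r} (f : Fin r → ℕ) → List.sum (tabulate f) ≡ sum f
  sum-tabulate {zero}  f = refl
  sum-tabulate {suc r} f = cong (λ x → f zero + x) (sum-tabulate (f ∘ suc))

  private
    indicator-sym : ∀ {r} (c i : Fin r) (σ : ℤ) → (if ⌊ i ≟ c ⌋ then σ else + 0) ≡ (if does (c ≟ i) then σ else + 0)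
    indicator-sym c i σ with c ≟ i | i ≟ c
    ... | yes _   | yes _   = refl
    ... | yes c≡i | no i≢c = ⊥-elim (i≢c (sym c≡i))
    ... | no c≢i | yes i≡c = ⊥-elim (c≢i (sym i≡c))
    ... | no _    | no _    = refl

    δ≡1⇒≡ : ∀ {r} {a i : Fin r} → δ a i ≡ 1 → a ≡ i
    δ≡1⇒≡ {a = a} {i} δ≡1 with a ≟ i
    ... | yes a≡i = a≡i
    ... | no _ with δ≡1
    ... | ()

    sum-δ-column : ∀ {r} (i : Fin r) → sum (λ c → δ c i) ≡ 1
    sum-δ-column i = trans (sum-cong-≗ (λ c → δ-sym c i)) (sum-δ i)

  edgeTypesOfValid : ∀ {k r j σ} → 2 ≤ r → Valid k r j σ → EdgeTypes k r j σ
  edgeTypesOfValid {k} {r} {j} 2≤r (inj₁ refl , size , _) = record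
    { edgeType           = λ c i → j i + δ c i
    ; edgeType-shifted   = λ c i → trans (shift (j i) (c ≟ i)) (cong (λ x → + j i ℤ.+ x) (sym (indicator-sym c i (+ 1))))
    ; edgeType-size      = λ c → trans (∑-distrib-+ j (δ c)) (trans (cong (λ x → sum j + x) (sum-δ c)) Σj+1≡k)
    ; edgeType-injective = λ c c′ eq → sym (δ≡1⇒≡ (sym (trans (sym (δ-refl c)) (+-cancelˡ-≡ (j c) _ _ (eq c)))))
    ; weight-int         = λ i → cong +_ (weight≡ i)
    ; weight-pos         = λ i → ≤-trans (m≤n+m 1 (r * j i)) (≤-reflexive (sym (weight≡ i)))
    }
    where
    Σj+1≡k : sum j + 1 ≡ k
    Σj+1≡k = trans (+-comm (sum j) 1) (ℤ.+-injective (trans (cong (λ x → + 1 ℤ.+ + x) (sym (sum-tabulate j))) size))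
    shift : ∀ x {P} (d : Dec P) → + (x + (if does d then 1 else 0)) ≡ + x ℤ.+ (if does d then + 1 else + 0)
    shift x (yes _) = refl
    shift x (no _)  = refl
    weight≡ : ∀ i → sum (λ c → j i + δ c i) ≡ r * j i + 1
    weight≡ i = trans (∑-distrib-+ (λ _ → j i) (λ c → δ c i)) (cong₂ _+_ (sum-const r (j i)) (sum-δ-column i))
  edgeTypesOfValid {k} {r} {j} 2≤r (inj₂ refl , size , nonNeg) = record
    { edgeType           = λ c i → j i ∸ δ c i
    ; edgeType-shifted   = λ c i → trans (shift (j i) (c ≟ i) (1≤j i)) (cong (λ x → + j i ℤ.+ x) (sym (indicator-sym c i -[1+ 0 ])))
    ; edgeType-size      = λ c → trans (∑-distrib-∸ j (δ c) (δ-≤ c j (1≤j c))) (cong₂ _∸_ Σj≡k+1 (sum-δ c))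
    ; edgeType-injective = injective
    ; weight-int         = λ i → trans (cong +_ (weight≡ i)) (∸1 (≤-trans (1≤j i) (m≤n*m (j i) r)))
    ; weight-pos         = λ i → ≤-trans (∸-monoˡ-≤ 1 (*-mono-≤ 2≤r (1≤j i))) (≤-reflexive (sym (weight≡ i)))
    }
    where
    instance
      r≢0 : NonZero r
      r≢0 = >-nonZero (≤-trans (s≤s z≤n) 2≤r)
    1≤j : ∀ i → 1 ≤ j i
    1≤j i with j i | nonNeg i
    ... | suc _ | _ = s≤s z≤n
    Σj≡k+1 : sum j ≡ suc k
    Σj≡k+1 = k+1 (sum j) (trans (cong (λ x → -[1+ 0 ] ℤ.+ + x) (sym (sum-tabulate j))) size)
      where
      k+1 : ∀ s → -[1+ 0 ] ℤ.+ + s ≡ + k → s ≡ suc k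
      k+1 (suc s) eq = cong suc (ℤ.+-injective eq)
    ∸1 : ∀ {x} → 1 ≤ x → + (x ∸ 1) ≡ + x ℤ.+ -[1+ 0 ]
    ∸1 (s≤s _) = refl
    shift : ∀ x {P} (d : Dec P) → 1 ≤ x → + (x ∸ (if does d then 1 else 0)) ≡ + x ℤ.+ (if does d then -[1+ 0 ] else + 0)
    shift x (yes _) 1≤x = ∸1 1≤x
    shift x (no _)  _   = sym (ℤ.+-identityʳ (+ x))
    weight≡ : ∀ i → sum (λ c → j i ∸ δ c i) ≡ r * j i ∸ 1
    weight≡ i = trans (∑-distrib-∸ (λ _ → j i) (λ c → δ c i) (λ c → ≤-trans (δ-≤ c (λ _ → 1) ≤-refl i) (1≤j i)))
                      (cong₂ _∸_ (sum-const r (j i)) (sum-δ-column i))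
    injective : ∀ c c′ → (λ i → j i ∸ δ c i) ≗ (λ i → j i ∸ δ c′ i) → c ≡ c′
    injective c c′ eq with c′ ≟ c
    ... | yes c′≡c = sym c′≡c
    ... | no c′≢c = ⊥-elim (m∸1≢m (1≤j c) (trans (cong (j c ∸_) (sym (δ-refl c))) (trans (eq c) (cong (j c ∸_) (δ-≢ c′≢c)))))
      where
      m∸1≢m : ∀ {m} → 1 ≤ m → m ∸ 1 ≢ m
      m∸1≢m {suc m} _ eq = 1+n≢n (sym eq)

module ColouredGraphs where

  open FiniteSums
  open Filtering
  open PartitionTypes
  open Extensions
  open ValidTypes
  import Data.Nat
  open import Data.Nat using (ℕ; zero; suc; _+_; _*_; _≤_; z≤n; s≤s)
  open import Data.Nat.Properties hiding (_≟_)
  open import Data.Fin using (Fin; zero; suc)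
  open import Data.Fin.Properties using (_≟_; any?; all?)
  open import Data.Fin.Subset using (Subset; ∣_∣; _∩_; ⊥; inside)
  open import Data.Vec using (_∷_)
  open import Data.Fin.Subset.Properties using (_⊆?_; ∣⊥∣≡0)
  open import Data.List.Extrema ≤-totalOrder using (argmin; argmin-all; f[argmin]≤f[xs])
  open import Data.Bool using (if_then_else_)
  open import Data.List using (List; []; _∷_; map; filter; length)
  open import Data.List.Properties using (length-map)
  import Data.Nat.ListAction as List
  open import Data.List.Membership.Propositional using (_∈_)
  open import Data.List.Membership.Propositional.Properties using (∈-filter⁺; ∈-filter⁻)
  open import Data.List.Relation.Unary.All as All using (All; []; _∷_)
  import Data.List.Relation.Unary.All.Properties as All
  open import Data.List.Relation.Unary.Any using (here; there)
  open import Data.List.Relation.Unary.Unique.Propositional using (Unique)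
  import Data.List.Relation.Unary.Unique.Propositional.Properties as Unique
  open import Data.Integer using (+_)
  import Data.Integer.Properties as ℤ
  open import Data.Product using (∃; _×_; _,_; proj₁; proj₂)
  open import Relation.Nullary using (¬_; Dec; yes; no; does)
  open import Relation.Binary.PropositionalEquality
  open import Data.Empty using (⊥-elim)
  open import Function using (_∘_)

  colourCount-∷ : ∀ {r n} (e : CEdge r n) M c → colourCount (e ∷ M) c ≡ δ (proj₂ e) c + colourCount M c
  colourCount-∷ e M c = length-filter-∷ (λ e → proj₂ e ≟ c) e M

  length≡sum-colourCount : ∀ {r n} (M : List (CEdge r n)) → length M ≡ sum (colourCount M)
  length≡sum-colourCount {r} []      = sym (sum-zero r)
  length≡sum-colourCount     (e ∷ M) = begin
    suc (length M)                                   ≡⟨ cong₂ _+_ (sum-δ (proj₂ e)) (sym (length≡sum-colourCount M)) ⟨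
    sum (δ (proj₂ e)) + sum (colourCount M)          ≡⟨ ∑-distrib-+ (δ (proj₂ e)) (colourCount M) ⟨
    sum (λ c → δ (proj₂ e) c + colourCount M c)      ≡⟨ sum-cong-≗ (colourCount-∷ e M) ⟨
    sum (colourCount (e ∷ M))                        ∎
    where open ≡-Reasoning

  sum-map-colour : ∀ {r n} (h : Fin r → ℕ) (M : List (CEdge r n)) →
                   List.sum (map (h ∘ proj₂) M) ≡ sum (λ c → h c * colourCount M c)
  sum-map-colour {r} h []      = sym (trans (sum-cong-≗ (λ c → *-zeroʳ (h c))) (sum-zero r))
  sum-map-colour     h (e ∷ M) = begin
    h (proj₂ e) + List.sum (map (h ∘ proj₂) M)                            ≡⟨ cong₂ _+_ (sum-δ* (proj₂ e) h) (sym (sum-map-colour h M)) ⟨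
    sum (λ c → δ (proj₂ e) c * h c) + sum (λ c → h c * colourCount M c)   ≡⟨ ∑-distrib-+ (λ c → δ (proj₂ e) c * h c) (λ c → h c * colourCount M c) ⟨
    sum (λ c → δ (proj₂ e) c * h c + h c * colourCount M c)               ≡⟨ sum-cong-≗ regroup ⟩
    sum (λ c → h c * colourCount (e ∷ M) c)                               ∎
    where
    open ≡-Reasoning
    regroup : ∀ c → δ (proj₂ e) c * h c + h c * colourCount M c ≡ h c * colourCount (e ∷ M) c
    regroup c = trans (cong (_+ h c * colourCount M c) (*-comm (δ (proj₂ e) c) (h c)))
                      (trans (sym (*-distribˡ-+ (h c) (δ (proj₂ e) c) (colourCount M c))) (cong (h c *_) (sym (colourCount-∷ e M c))))

  module TypedGraph {k r n j σ} (types : EdgeTypes k r j σ) (H : CGraph k r n) (p : Fin n → Fin r)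
                    (typed : EdgesTyped H p j σ) where

    open EdgeTypes types

    edge-type : ∀ {e} → e ∈ edges H → type p (proj₁ e) ≗ edgeType (proj₂ e)
    edge-type {e} e∈H i = ℤ.+-injective (trans (All.lookup typed e∈H i) (sym (edgeType-shifted (proj₂ e) i)))

    deg≤sum-extensions : ∀ S → deg H S ≤ sum (λ c → extensions p S (edgeType c))
    deg≤sum-extensions S = ≤-trans (≤-reflexive (length≡sum-colourCount L)) (sum-mono-≤ colour≤)
      where
      L = filter (λ e → S ⊆? proj₁ e) (edges H)
      colour≤ : ∀ c → colourCount L c ≤ extensions p S (edgeType c)
      colour≤ c = begin
        colourCount L c               ≡⟨ length-map proj₁ Lc ⟨
        length (map proj₁ Lc)         ≤⟨ Unique-⊆⇒length-≤ _ _ unique (All.map⁺ (All.tabulate extension)) ⟩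
        extensions p S (edgeType c)   ∎
        where
        open ≤-Reasoning
        Lc = filter (λ e → proj₂ e ≟ c) L
        unique : Unique (map proj₁ Lc)
        unique = Unique-map-filter proj₁ _ L (Unique-map-filter proj₁ _ (edges H) (distinct H))
        extension : ∀ {e} → e ∈ Lc → proj₁ e ∈ filter (extensionOfType? p S (edgeType c)) (allSubsets n)
        extension e∈Lc with ∈-filter⁻ (λ e → proj₂ e ≟ c) {xs = L} e∈Lc
        ... | e∈L , refl with ∈-filter⁻ (λ e → S ⊆? proj₁ e) {xs = edges H} e∈L
        ... | e∈H , S⊆e = ∈-filter⁺ (extensionOfType? p S (edgeType c)) (∈-allSubsets _) (S⊆e , edge-type e∈H)

    part≤matching : ∀ {M} → PerfectMatching H M → ∀ i → ∣ part p i ∣ ≤ sum (λ c → edgeType c i * colourCount M c)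
    part≤matching {M} (M⊆H , _ , covers) i = begin
      ∣ part p i ∣                                      ≤⟨ ∣p∣≤sum-∣q∩p∣ proj₁ M (part p i) (λ {v} _ → covers v) ⟩
      List.sum (map (λ e → ∣ proj₁ e ∩ part p i ∣) M)  ≡⟨ cong List.sum (map-cong-∈ M λ e∈M → edge-type (All.lookup M⊆H e∈M) i) ⟩
      List.sum (map (λ e → edgeType (proj₂ e) i) M)     ≡⟨ sum-map-colour (λ c → edgeType c i) M ⟩
      sum (λ c → edgeType c i * colourCount M c)        ∎
      where
      open ≤-Reasoning
      map-cong-∈ : ∀ {A B : Set} {f g : A → B} xs → (∀ {x} → x ∈ xs → f x ≡ g x) → map f xs ≡ map g xs
      map-cong-∈ []       _  = refl
      map-cong-∈ (x ∷ xs) eq = cong₂ _∷_ (eq (here refl)) (map-cong-∈ xs (eq ∘ there))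

  module CompleteGraph {k r N j σ} (types : EdgeTypes k r j σ) (p : Fin N → Fin r) where

    open EdgeTypes types

    HasEdgeType : Subset N → Set
    HasEdgeType T = ∃ λ c → type p T ≗ edgeType c

    hasEdgeType? : ∀ T → Dec (HasEdgeType T)
    hasEdgeType? T = any? (λ c → all? (λ i → type p T i Data.Nat.≟ edgeType c i))

    colour : List (Subset N) → List (CEdge r N)
    colour []       = []
    colour (T ∷ Ts) with hasEdgeType? T
    ... | yes (c , _) = (T , c) ∷ colour Ts
    ... | no _        = colour Ts

    colour-type : ∀ Ts → All (λ e → type p (proj₁ e) ≗ edgeType (proj₂ e)) (colour Ts)
    colour-type []       = []
    colour-type (T ∷ Ts) with hasEdgeType? T
    ... | yes (_ , hT) = hT ∷ colour-type Ts
    ... | no _         = colour-type Ts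

    map-proj₁-colour : ∀ Ts → map proj₁ (colour Ts) ≡ filter hasEdgeType? Ts
    map-proj₁-colour []       = refl
    map-proj₁-colour (T ∷ Ts) with hasEdgeType? T
    ... | yes _ = cong (T ∷_) (map-proj₁-colour Ts)
    ... | no _  = map-proj₁-colour Ts

    completeGraph : CGraph k r N
    completeGraph = record
      { edges    = colour (allSubsets N)
      ; distinct = subst Unique (sym (map-proj₁-colour (allSubsets N))) (Unique.filter⁺ hasEdgeType? (allSubsets-unique N))
      ; uniform  = All.map (λ {e} hT → trans (sym (sum-type p (proj₁ e))) (trans (sum-cong-≗ hT) (edgeType-size (proj₂ e))))
                           (colour-type (allSubsets N))
      }

    completeGraph-typed : EdgesTyped completeGraph p j σ
    completeGraph-typed = All.map (λ {e} hT i → trans (cong +_ (hT i)) (edgeType-shifted (proj₂ e) i)) (colour-type (allSubsets N))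

    private
      indicator : ∀ {P : Set} → Dec P → ℕ
      indicator d = if does d then 1 else 0

      indicator-yes : ∀ {P : Set} (d : Dec P) → P → indicator d ≡ 1
      indicator-yes (yes _) _  = refl
      indicator-yes (no ¬P) P = ⊥-elim (¬P P)

      oneColour : ∀ S T c₀ → type p T ≗ edgeType c₀ →
                  ∀ c → indicator (extensionOfType? p S (edgeType c) T) ≤ δ c₀ c * indicator (S ⊆? T)
      oneColour S T c₀ hT c = bound (extensionOfType? p S (edgeType c) T)
        where
        bound : (d : Dec (ExtensionOfType p S (edgeType c) T)) → indicator d ≤ δ c₀ c * indicator (S ⊆? T)
        bound (no _)               = z≤n
        bound (yes (S⊆T , hT′)) with edgeType-injective c₀ c (λ i → trans (sym (hT i)) (hT′ i))
        ... | refl = ≤-reflexive (sym (cong₂ _*_ (δ-refl c) (indicator-yes (S ⊆? T) S⊆T)))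

      noColour : ∀ S T → ¬ HasEdgeType T → ∀ c → indicator (extensionOfType? p S (edgeType c) T) ≡ 0
      noColour S T ∄c c = none (extensionOfType? p S (edgeType c) T)
        where
        none : (d : Dec (ExtensionOfType p S (edgeType c) T)) → indicator d ≡ 0
        none (no _)          = refl
        none (yes (_ , hT)) = ⊥-elim (∄c (c , hT))

    sum-extensions≤deg : ∀ S Ts → sum (λ c → length (filter (extensionOfType? p S (edgeType c)) Ts))
                                  ≤ length (filter (λ e → S ⊆? proj₁ e) (colour Ts))
    sum-extensions≤deg S []       = ≤-reflexive (sum-zero r)
    sum-extensions≤deg S (T ∷ Ts) with hasEdgeType? T
    ... | yes (c₀ , hT) = begin
      sum (λ c → length (filter (ext c) (T ∷ Ts)))                         ≡⟨ sum-cong-≗ (λ c → length-filter-∷ (ext c) T Ts) ⟩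
      sum (λ c → indicator (ext c T) + length (filter (ext c) Ts))         ≡⟨ ∑-distrib-+ (λ c → indicator (ext c T)) _ ⟩
      sum (λ c → indicator (ext c T)) + sum (λ c → length (filter (ext c) Ts))
                                        ≤⟨ +-mono-≤ (sum-mono-≤ (oneColour S T c₀ hT)) (sum-extensions≤deg S Ts) ⟩
      sum (λ c → δ c₀ c * indicator (S ⊆? T)) + length (filter (λ e → S ⊆? proj₁ e) (colour Ts))
                                        ≡⟨ cong (_+ _) (sum-δ* c₀ (λ _ → indicator (S ⊆? T))) ⟩
      indicator (S ⊆? T) + length (filter (λ e → S ⊆? proj₁ e) (colour Ts)) ≡⟨ length-filter-∷ (λ e → S ⊆? proj₁ e) (T , c₀) (colour Ts) ⟨
      length (filter (λ e → S ⊆? proj₁ e) ((T , c₀) ∷ colour Ts))          ∎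
      where
      open ≤-Reasoning
      ext = λ c → extensionOfType? p S (edgeType c)
    ... | no ∄c = begin
      sum (λ c → length (filter (ext c) (T ∷ Ts)))
          ≡⟨ sum-cong-≗ (λ c → trans (length-filter-∷ (ext c) T Ts) (cong (_+ length (filter (ext c) Ts)) (noColour S T ∄c c))) ⟩
      sum (λ c → length (filter (ext c) Ts))                                ≤⟨ sum-extensions≤deg S Ts ⟩
      length (filter (λ e → S ⊆? proj₁ e) (colour Ts))                      ∎
      where
      open ≤-Reasoning
      ext = λ c → extensionOfType? p S (edgeType c)

    sum-extensions≤deg-complete : ∀ S → sum (λ c → extensions p S (edgeType c)) ≤ deg completeGraph S
    sum-extensions≤deg-complete S = sum-extensions≤deg S (allSubsets N)

  subsetOfSize : ∀ {n ℓ} → ℓ ≤ n → ∃ λ (S : Subset n) → ∣ S ∣ ≡ ℓ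
  subsetOfSize {n} {zero}      _         = ⊥ , ∣⊥∣≡0 n
  subsetOfSize {suc n} {suc ℓ} (s≤s ℓ≤n) = let (S , ∣S∣≡ℓ) = subsetOfSize ℓ≤n in inside ∷ S , cong suc ∣S∣≡ℓ

  minDegree-attained : ∀ {k r n} (H : CGraph k r n) ℓ → ℓ ≤ n → ∃ λ S → ∣ S ∣ ≡ ℓ × MinDegAtLeast H ℓ (deg H S)
  minDegree-attained {n = n} H ℓ ℓ≤n = S* , ∣S*∣≡ℓ , minimal
    where
    ℓ-sets = filter (λ S → ∣ S ∣ Data.Nat.≟ ℓ) (allSubsets n)
    S₀ = proj₁ (subsetOfSize ℓ≤n)
    S* = argmin (deg H) S₀ ℓ-sets
    ∣S*∣≡ℓ : ∣ S* ∣ ≡ ℓ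
    ∣S*∣≡ℓ = argmin-all (deg H) (proj₂ (subsetOfSize ℓ≤n)) (All.all-filter (λ S → ∣ S ∣ Data.Nat.≟ ℓ) (allSubsets n))
    minimal : MinDegAtLeast H ℓ (deg H S*)
    minimal S ∣S∣≡ℓ = All.lookup (f[argmin]≤f[xs] S₀ ℓ-sets) (∈-filter⁺ (λ S → ∣ S ∣ Data.Nat.≟ ℓ) (∈-allSubsets S) ∣S∣≡ℓ)

module RatioBounds where

  open FiniteSums
  open Binomials
  open import Data.Nat using (ℕ; zero; suc; _+_; _*_; _∸_; _^_; _!; _≤_; z≤n; NonZero; >-nonZero)
  open import Data.Nat.Properties
  open import Data.Nat.Combinatorics using (_C_)
  open import Data.Fin using (Fin; zero; suc)
  open import Relation.Binary.PropositionalEquality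
  open import Function using (_∘_)
  open import Data.Nat.Solver using (module +-*-Solver)
  open +-*-Solver

  pow-perturbation : ∀ X Y Z c u → Y ≤ X → X ≤ Z → X ≤ Y + c → Z * X ^ u ≤ Z * Y ^ u + u * c * Z ^ u
  pow-perturbation X Y Z c zero    _   _   _     = m≤m+n _ _
  pow-perturbation X Y Z c (suc u) Y≤X X≤Z X≤Y+c = begin
    Z * (X * X ^ u)                                     ≡⟨ solve 3 (λ z x p → z :* (x :* p) := x :* (z :* p)) refl Z X (X ^ u) ⟩
    X * (Z * X ^ u)                                     ≤⟨ *-monoʳ-≤ X (pow-perturbation X Y Z c u Y≤X X≤Z X≤Y+c) ⟩
    X * (Z * Y ^ u + u * c * Z ^ u)                     ≡⟨ *-distribˡ-+ X (Z * Y ^ u) _ ⟩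
    X * (Z * Y ^ u) + X * (u * c * Z ^ u)               ≤⟨ +-mono-≤ (*-monoˡ-≤ (Z * Y ^ u) X≤Y+c) (*-monoˡ-≤ (u * c * Z ^ u) X≤Z) ⟩
    (Y + c) * (Z * Y ^ u) + Z * (u * c * Z ^ u)
        ≡⟨ solve 6 (λ y c z p u q → (y :+ c) :* (z :* p) :+ z :* (u :* c :* q)
                                  := z :* (y :* p) :+ (c :* (z :* p) :+ u :* c :* (z :* q))) refl Y c Z (Y ^ u) u (Z ^ u) ⟩
    Z * (Y * Y ^ u) + (c * (Z * Y ^ u) + u * c * (Z * Z ^ u))
        ≤⟨ +-monoʳ-≤ (Z * (Y * Y ^ u)) (+-monoˡ-≤ _ (*-monoʳ-≤ c (*-monoʳ-≤ Z (^-monoˡ-≤ u (≤-trans Y≤X X≤Z))))) ⟩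
    Z * (Y * Y ^ u) + (c * (Z * Z ^ u) + u * c * (Z * Z ^ u))
        ≡⟨ cong (Z * (Y * Y ^ u) +_) (solve 3 (λ c q u → c :* q :+ u :* c :* q := (con 1 :+ u) :* c :* q) refl c (Z * Z ^ u) u) ⟩
    Z * (Y * Y ^ u) + suc u * c * (Z * Z ^ u)           ∎
    where open ≤-Reasoning

  product-^≤^-sum : ∀ {r} (X u : Fin r → ℕ) Z → (∀ i → X i ≤ Z) → product (λ i → X i ^ u i) ≤ Z ^ sum u
  product-^≤^-sum X u Z X≤Z = ≤-trans (product-mono-≤ (λ i → ^-monoˡ-≤ (u i) (X≤Z i))) (≤-reflexive (sym (^-sum Z u)))

  product-^-*ʳ : ∀ {r} (X u : Fin r → ℕ) c → product (λ i → (X i * c) ^ u i) ≡ product (λ i → X i ^ u i) * c ^ sum u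
  product-^-*ʳ X u c = trans (product-cong-≗ (λ i → ^-distribʳ-* (X i) c (u i)))
                             (trans (product-distrib-* (λ i → X i ^ u i) (λ i → c ^ u i)) (cong (product (λ i → X i ^ u i) *_) (sym (^-sum c u))))

  product-pow-perturbation : ∀ {r} (X Y u : Fin r → ℕ) Z c → (∀ i → Y i ≤ X i) → (∀ i → X i ≤ Z) → (∀ i → X i ≤ Y i + c) →
                             Z * product (λ i → X i ^ u i) ≤ Z * product (λ i → Y i ^ u i) + sum u * c * Z ^ sum u
  product-pow-perturbation {zero}  X Y u Z c _   _   _     = m≤m+n _ _
  product-pow-perturbation {suc r} X Y u Z c Y≤X X≤Z X≤Y+c = begin
    Z * (A * B)                                  ≡⟨ solve 3 (λ z a b → z :* (a :* b) := a :* (z :* b)) refl Z A B ⟩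
    A * (Z * B)
        ≤⟨ *-monoʳ-≤ A (product-pow-perturbation (X ∘ suc) (Y ∘ suc) (u ∘ suc) Z c (Y≤X ∘ suc) (X≤Z ∘ suc) (X≤Y+c ∘ suc)) ⟩
    A * (Z * B′ + U₁ * c * Z ^ U₁)
        ≡⟨ solve 6 (λ a z b′ u₁ c q → a :* (z :* b′ :+ u₁ :* c :* q) := b′ :* (z :* a) :+ a :* (u₁ :* c :* q)) refl A Z B′ U₁ c (Z ^ U₁) ⟩
    B′ * (Z * A) + A * (U₁ * c * Z ^ U₁)
        ≤⟨ +-mono-≤ (*-monoʳ-≤ B′ (pow-perturbation (X zero) (Y zero) Z c U₀ (Y≤X zero) (X≤Z zero) (X≤Y+c zero)))
                                                             (*-monoˡ-≤ (U₁ * c * Z ^ U₁) (^-monoˡ-≤ U₀ (X≤Z zero))) ⟩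
    B′ * (Z * A′ + U₀ * c * Z ^ U₀) + Z ^ U₀ * (U₁ * c * Z ^ U₁)
        ≡⟨ solve 8 (λ b′ z a′ u₀ c q₀ u₁ q₁ → b′ :* (z :* a′ :+ u₀ :* c :* q₀) :+ q₀ :* (u₁ :* c :* q₁)
                      := z :* (a′ :* b′) :+ (u₀ :* c :* (q₀ :* b′) :+ u₁ :* c :* (q₀ :* q₁))) refl B′ Z A′ U₀ c (Z ^ U₀) U₁ (Z ^ U₁) ⟩
    Z * (A′ * B′) + (U₀ * c * (Z ^ U₀ * B′) + U₁ * c * (Z ^ U₀ * Z ^ U₁))
        ≤⟨ +-monoʳ-≤ (Z * (A′ * B′)) (+-monoˡ-≤ _ (*-monoʳ-≤ (U₀ * c) (*-monoʳ-≤ (Z ^ U₀)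
             (product-^≤^-sum (Y ∘ suc) (u ∘ suc) Z (λ i → ≤-trans (Y≤X (suc i)) (X≤Z (suc i))))))) ⟩
    Z * (A′ * B′) + (U₀ * c * (Z ^ U₀ * Z ^ U₁) + U₁ * c * (Z ^ U₀ * Z ^ U₁))
        ≡⟨ cong (Z * (A′ * B′) +_) (trans (sym (*-distribʳ-+ _ (U₀ * c) (U₁ * c)))
                                          (cong₂ _*_ (sym (*-distribʳ-+ c U₀ U₁)) (sym (^-distribˡ-+-* Z U₀ U₁)))) ⟩
    Z * (A′ * B′) + (U₀ + U₁) * c * Z ^ (U₀ + U₁) ∎
    where
    open ≤-Reasoning
    U₀ = u zero
    U₁ = sum (u ∘ suc)
    A  = X zero ^ U₀
    A′ = Y zero ^ U₀
    B  = product (λ i → X (suc i) ^ u (suc i))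
    B′ = product (λ i → Y (suc i) ^ u (suc i))

  -- a / b ≤ c / d + 1 / e, with the denominators cleared
  RatioExcess≤ : (e a b c d : ℕ) → Set
  RatioExcess≤ e a b c d = e * a * d ≤ e * c * b + b * d

  RatioExcess≤-zero : ∀ e b c d → RatioExcess≤ e 0 b c d
  RatioExcess≤-zero e b c d rewrite *-zeroʳ e = z≤n

  RatioExcess≤-mono : ∀ {e a a′ b c c′ d} → a′ ≤ a → c ≤ c′ → RatioExcess≤ e a b c d → RatioExcess≤ e a′ b c′ d
  RatioExcess≤-mono {e} {b = b} {d = d} a′≤a c≤c′ bound =
    ≤-trans (*-monoˡ-≤ d (*-monoʳ-≤ e a′≤a)) (≤-trans bound (+-monoˡ-≤ (b * d) (*-monoˡ-≤ b (*-monoʳ-≤ e c≤c′))))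

  RatioExcess≤-sum : ∀ {r} e (a c : Fin r → ℕ) b d .{{_ : NonZero r}} →
                     (∀ i → RatioExcess≤ (r * e) (a i) b (c i) d) → RatioExcess≤ e (sum a) b (sum c) d
  RatioExcess≤-sum {r} e a c b d bounds = *-cancelˡ-≤ r (begin
    r * (e * sum a * d)                  ≡⟨ solve 4 (λ r e s d → r :* (e :* s :* d) := s :* (r :* e :* d)) refl r e (sum a) d ⟩
    sum a * (r * e * d)                  ≡⟨ *-distribʳ-sum (r * e * d) a ⟩
    sum (λ i → a i * (r * e * d))        ≡⟨ sum-cong-≗ (λ i → solve 4 (λ a r e d → a :* (r :* e :* d) := r :* e :* a :* d) refl (a i) r e d) ⟩
    sum (λ i → r * e * a i * d)          ≤⟨ sum-mono-≤ bounds ⟩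
    sum (λ i → r * e * c i * b + b * d)  ≡⟨ ∑-distrib-+ (λ i → r * e * c i * b) (λ _ → b * d) ⟩
    sum (λ i → r * e * c i * b) + sum {r} (λ _ → b * d)
        ≡⟨ cong₂ _+_ (sum-cong-≗ (λ i → solve 4 (λ r e c b → r :* e :* c :* b := c :* (r :* e :* b)) refl r e (c i) b)) (sum-const r (b * d)) ⟩
    sum (λ i → c i * (r * e * b)) + r * (b * d)
        ≡⟨ cong (_+ r * (b * d)) (*-distribʳ-sum (r * e * b) c) ⟨
    sum c * (r * e * b) + r * (b * d)
        ≡⟨ solve 5 (λ s r e b x → s :* (r :* e :* b) :+ r :* x := r :* (e :* s :* b :+ x)) refl (sum c) r e b (b * d) ⟩
    r * (e * sum c * b + b * d)          ∎)
    where open ≤-Reasoning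

  -- PH/QH ≤ PX/V and PY/V ≤ PK/QK, while (PX − PY)/V ≤ D/Z ≤ 1/E
  RatioExcess≤-sandwich : ∀ {E PH QH PK QK PX PY V Z D} .{{_ : NonZero Z}} .{{_ : NonZero V}} →
                          V * PH ≤ PX * QH → PY * QK ≤ V * PK → Z * PX ≤ Z * PY + D * V → D * E ≤ Z →
                          RatioExcess≤ E PH QH PK QK
  RatioExcess≤-sandwich {E} {PH} {QH} {PK} {QK} {PX} {PY} {V} {Z} {D} PH≤ ≤PK PX≤ DE≤Z = *-cancelˡ-≤ (Z * V) {{m*n≢0 Z V}} (begin
    Z * V * (E * PH * QK)                 ≡⟨ solve 5 (λ z v e p k → z :* v :* (e :* p :* k) := z :* e :* k :* (v :* p)) refl Z V E PH QK ⟩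
    Z * E * QK * (V * PH)                 ≤⟨ *-monoʳ-≤ (Z * E * QK) PH≤ ⟩
    Z * E * QK * (PX * QH)                ≡⟨ solve 5 (λ z e k x h → z :* e :* k :* (x :* h) := e :* k :* h :* (z :* x)) refl Z E QK PX QH ⟩
    E * QK * QH * (Z * PX)                ≤⟨ *-monoʳ-≤ (E * QK * QH) PX≤ ⟩
    E * QK * QH * (Z * PY + D * V)
        ≡⟨ solve 7 (λ e k h z y d v → e :* k :* h :* (z :* y :+ d :* v) := z :* e :* h :* (y :* k) :+ d :* e :* (h :* k :* v)) refl E QK QH Z PY D V ⟩
    Z * E * QH * (PY * QK) + D * E * (QH * QK * V)
        ≤⟨ +-mono-≤ (*-monoʳ-≤ (Z * E * QH) ≤PK) (*-monoˡ-≤ (QH * QK * V) DE≤Z) ⟩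
    Z * E * QH * (V * PK) + Z * (QH * QK * V)
        ≡⟨ solve 6 (λ z e h v p k → z :* e :* h :* (v :* p) :+ z :* (h :* k :* v) := z :* v :* (e :* p :* h :+ h :* k)) refl Z E QH V PK QK ⟩
    Z * V * (E * PK * QH + QH * QK)       ∎)
    where open ≤-Reasoning

  RatioExcess≤-rescale : ∀ {E a c W PH PK QH QK B B′ F} .{{_ : NonZero QH}} .{{_ : NonZero QK}} .{{_ : NonZero W}} .{{_ : NonZero F}} →
                         a * W ≤ PH → PK ≤ c * W → QH ≤ B * F → B′ * F ≤ QK →
                         RatioExcess≤ (E * F) PH QH PK QK → RatioExcess≤ E a B c B′
  RatioExcess≤-rescale {E} {a} {c} {W} {PH} {PK} {QH} {QK} {B} {B′} {F} aW≤ ≤cW QH≤ ≤QK excess =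
    *-cancelˡ-≤ W (≤-trans scaled (≤-trans (+-monoʳ-≤ (W * (E * c * B)) (m≤n*m (B * B′) W)) (≤-reflexive (sym (*-distribˡ-+ W (E * c * B) (B * B′))))))
    where
    open ≤-Reasoning
    EF = E * F
    BF = B * F
    B′F = B′ * F
    cleared : QH * QK * (EF * (a * W) * B′F) ≤ QH * QK * (EF * (c * W) * BF + BF * B′F)
    cleared = begin
      QH * QK * (EF * (a * W) * B′F)       ≡⟨ solve 5 (λ h k e x y → h :* k :* (e :* x :* y) := e :* y :* k :* (x :* h)) refl QH QK EF (a * W) B′F ⟩
      EF * B′F * QK * (a * W * QH)         ≤⟨ *-monoʳ-≤ (EF * B′F * QK) (*-mono-≤ aW≤ QH≤) ⟩
      EF * B′F * QK * (PH * BF)            ≡⟨ solve 5 (λ e y k p x → e :* y :* k :* (p :* x) := x :* y :* (e :* p :* k)) refl EF B′F QK PH BF ⟩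
      BF * B′F * (EF * PH * QK)            ≤⟨ *-monoʳ-≤ (BF * B′F) excess ⟩
      BF * B′F * (EF * PK * QH + QH * QK)
          ≡⟨ solve 6 (λ x y e p h k → x :* y :* (e :* p :* h :+ h :* k) := e :* x :* h :* (p :* y) :+ x :* y :* h :* k) refl BF B′F EF PK QH QK ⟩
      EF * BF * QH * (PK * B′F) + BF * B′F * QH * QK
          ≤⟨ +-monoˡ-≤ (BF * B′F * QH * QK) (*-monoʳ-≤ (EF * BF * QH) (*-mono-≤ ≤cW ≤QK)) ⟩
      EF * BF * QH * (c * W * QK) + BF * B′F * QH * QK
          ≡⟨ solve 6 (λ e x h m k y → e :* x :* h :* (m :* k) :+ x :* y :* h :* k := h :* k :* (e :* m :* x :+ x :* y)) refl EF BF QH (c * W) QK B′F ⟩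
      QH * QK * (EF * (c * W) * BF + BF * B′F) ∎
    scaled : W * (E * a * B′) ≤ W * (E * c * B) + B * B′
    scaled = *-cancelˡ-≤ (F * F) {{m*n≢0 F F}} (begin
      F * F * (W * (E * a * B′))
          ≡⟨ solve 5 (λ f w e a b → f :* f :* (w :* (e :* a :* b)) := e :* f :* (a :* w) :* (b :* f)) refl F W E a B′ ⟩
      EF * (a * W) * B′F                     ≤⟨ *-cancelˡ-≤ (QH * QK) {{m*n≢0 QH QK}} cleared ⟩
      EF * (c * W) * BF + BF * B′F
          ≡⟨ solve 6 (λ e f c w b b′ → e :* f :* (c :* w) :* (b :* f) :+ b :* f :* (b′ :* f) := f :* f :* (w :* (e :* c :* b) :+ b :* b′)) refl E F c W B B′ ⟩
      F * F * (W * (E * c * B) + B * B′)     ∎)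

  product-C*!≤product-^ : ∀ {r} (x u : Fin r → ℕ) → product (λ i → x i C u i) * product (λ i → u i !) ≤ product (λ i → x i ^ u i)
  product-C*!≤product-^ x u = ≤-trans (≤-reflexive (sym (product-distrib-* (λ i → x i C u i) (λ i → u i !))))
                                      (product-mono-≤ (λ i → C*!≤^ (x i) (u i)))

  product-∸^≤product-C*! : ∀ {r} (y u : Fin r → ℕ) → product (λ i → (y i ∸ u i) ^ u i) ≤ product (λ i → y i C u i) * product (λ i → u i !)
  product-∸^≤product-C*! y u = ≤-trans (product-mono-≤ (λ i → ∸^≤C*! (y i) (u i)))
                                       (≤-reflexive (product-distrib-* (λ i → y i C u i) (λ i → u i !)))

  product-binomial-ratio : ∀ {r} (u x y X Y : Fin r → ℕ) (n′ N Z E B B′ : ℕ) .{{_ : NonZero n′}} .{{_ : NonZero N}} .{{_ : NonZero Z}} →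
                           (∀ i → Z * x i ≤ X i * n′) → (∀ i → Y i * N ≤ (y i ∸ u i) * Z) →
                           (∀ i → Y i ≤ X i) → (∀ i → X i ≤ Z) → (∀ i → X i ≤ Y i + 2) →
                           sum u * 2 * (E * sum u !) ≤ Z → n′ ^ sum u ≤ B * sum u ! → B′ * sum u ! ≤ N ^ sum u →
                           RatioExcess≤ E (product (λ i → x i C u i)) B (product (λ i → y i C u i)) B′
  product-binomial-ratio u x y X Y n′ N Z E B B′ Zx≤Xn′ YN≤yZ Y≤X X≤Z X≤Y+2 Z-large n′^≤B B′≤N^ =
    RatioExcess≤-rescale {E} {F = U !} (product-C*!≤product-^ x u) (product-∸^≤product-C*! y u) n′^≤B B′≤N^
      (RatioExcess≤-sandwich {E * U !} {V = Z ^ U} {Z} {U * 2} PH≤ ≤PK (product-pow-perturbation X Y u Z 2 Y≤X X≤Z X≤Y+2) Z-large)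
    where
    open ≤-Reasoning
    U = sum u
    instance
      n′^U≢0 : NonZero (n′ ^ U)
      n′^U≢0 = m^n≢0 n′ U
      N^U≢0 : NonZero (N ^ U)
      N^U≢0 = m^n≢0 N U
      Z^U≢0 : NonZero (Z ^ U)
      Z^U≢0 = m^n≢0 Z U
      U!≢0 : NonZero (U !)
      U!≢0 = U !≢0
      W≢0 : NonZero (product (λ i → u i !))
      W≢0 = >-nonZero (product-pos _ (λ i → 1≤n! (u i)))
    PH≤ : Z ^ U * product (λ i → x i ^ u i) ≤ product (λ i → X i ^ u i) * n′ ^ U
    PH≤ = begin
      Z ^ U * product (λ i → x i ^ u i)   ≡⟨ *-comm (Z ^ U) _ ⟩
      product (λ i → x i ^ u i) * Z ^ U   ≡⟨ product-^-*ʳ x u Z ⟨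
      product (λ i → (x i * Z) ^ u i)     ≤⟨ product-mono-≤ (λ i → ^-monoˡ-≤ (u i) (≤-trans (≤-reflexive (*-comm (x i) Z)) (Zx≤Xn′ i))) ⟩
      product (λ i → (X i * n′) ^ u i)    ≡⟨ product-^-*ʳ X u n′ ⟩
      product (λ i → X i ^ u i) * n′ ^ U  ∎
    ≤PK : product (λ i → Y i ^ u i) * N ^ U ≤ Z ^ U * product (λ i → (y i ∸ u i) ^ u i)
    ≤PK = begin
      product (λ i → Y i ^ u i) * N ^ U             ≡⟨ product-^-*ʳ Y u N ⟨
      product (λ i → (Y i * N) ^ u i)               ≤⟨ product-mono-≤ (λ i → ^-monoˡ-≤ (u i) (YN≤yZ i)) ⟩
      product (λ i → ((y i ∸ u i) * Z) ^ u i)       ≡⟨ product-^-*ʳ (λ i → y i ∸ u i) u Z ⟩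
      product (λ i → (y i ∸ u i) ^ u i) * Z ^ U     ≡⟨ *-comm _ (Z ^ U) ⟩
      Z ^ U * product (λ i → (y i ∸ u i) ^ u i)     ∎

module PartSizes where

  open FiniteSums
  open import Data.Nat using (ℕ; zero; suc; _+_; _*_; _∸_; _≤_; z≤n; s≤s; NonZero)
  open import Data.Nat.Properties
  open import Data.Fin using (Fin)
  open import Relation.Binary.PropositionalEquality
  open import Data.Nat.Solver using (module +-*-Solver)
  open +-*-Solver

  part-upper : ∀ x a n G G′ rk .{{_ : NonZero G′}} → x * (rk * G′) ≤ a * (n * G′ + n * rk) → a ≤ rk → 2 * G * rk * rk ≤ G′ →
               2 * (rk * G) * x ≤ 2 * a * G * n + n
  part-upper x a n G G′ rk hx a≤rk G′-large = *-cancelˡ-≤ G′ (begin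
    G′ * (2 * (rk * G) * x)
        ≡⟨ solve 4 (λ g′ rk g x → g′ :* (con 2 :* (rk :* g) :* x) := con 2 :* g :* (x :* (rk :* g′))) refl G′ rk G x ⟩
    2 * G * (x * (rk * G′))                     ≤⟨ *-monoʳ-≤ (2 * G) hx ⟩
    2 * G * (a * (n * G′ + n * rk))
        ≡⟨ solve 5 (λ g a n g′ rk → con 2 :* g :* (a :* (n :* g′ :+ n :* rk))
                                  := g′ :* (con 2 :* a :* g :* n) :+ con 2 :* g :* a :* rk :* n) refl G a n G′ rk ⟩
    G′ * (2 * a * G * n) + 2 * G * a * rk * n
        ≤⟨ +-monoʳ-≤ (G′ * (2 * a * G * n)) (*-monoˡ-≤ n (≤-trans (*-monoˡ-≤ rk (*-monoʳ-≤ (2 * G) a≤rk)) G′-large)) ⟩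
    G′ * (2 * a * G * n) + G′ * n               ≡⟨ *-distribˡ-+ G′ (2 * a * G * n) n ⟨
    G′ * (2 * a * G * n + n)                    ∎)
    where open ≤-Reasoning

  part-upper-∸ : ∀ Z x a G n k → 2 * Z * x ≤ 2 * a * G * n + n → 2 * (a * G + 1) * k ≤ n → Z * x ≤ (a * G + 1) * (n ∸ k)
  part-upper-∸ Z x a G n k hx n-large = *-cancelˡ-≤ 2 (+-cancelʳ-≤ (2 * X * k) _ _ (begin
    2 * (Z * x) + 2 * X * k          ≡⟨ cong (_+ 2 * X * k) (*-assoc 2 Z x) ⟨
    2 * Z * x + 2 * X * k            ≤⟨ +-mono-≤ hx n-large ⟩
    2 * a * G * n + n + n            ≡⟨ solve 3 (λ a g n → con 2 :* a :* g :* n :+ n :+ n := con 2 :* (a :* g :+ con 1) :* n) refl a G n ⟩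
    2 * X * n                        ≡⟨ cong (2 * X *_) (m∸n+n≡m k≤n) ⟨
    2 * X * (n ∸ k + k)              ≡⟨ solve 3 (λ x m k → con 2 :* x :* (m :+ k) := con 2 :* (x :* m) :+ con 2 :* x :* k) refl X (n ∸ k) k ⟩
    2 * (X * (n ∸ k)) + 2 * X * k    ∎))
    where
    open ≤-Reasoning
    X = a * G + 1
    k≤n : k ≤ n
    k≤n = ≤-trans (m≤m+n k _) (≤-trans (≤-reflexive 2Xk≡) n-large)
      where
      2Xk≡ : k + (k + 2 * (a * G) * k) ≡ 2 * X * k
      2Xk≡ = solve 3 (λ a g k → k :+ (k :+ con 2 :* (a :* g) :* k) := con 2 :* (a :* g :+ con 1) :* k) refl a G k

  part-lower : ∀ {r} (x a : Fin r → ℕ) n G rk ℓ .{{_ : NonZero G}} .{{_ : NonZero rk}} →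
               (∀ i → 2 * (rk * G) * x i ≤ 2 * a i * G * n + n) → sum x ≡ n → sum a ≡ rk →
               (∀ i → 1 ≤ a i) → r ≤ G → 2 * rk * ℓ ≤ n → ∀ i → ℓ ≤ x i
  part-lower {r} x a n G rk ℓ x≤ Σx≡n Σa≡rk 1≤a r≤G n-large i =
    *-cancelˡ-≤ (2 * rk) {{m*n≢0 2 rk}} (≤-trans n-large n≤2rkx)
    where
    open ≤-Reasoning
    v w : Fin r → ℕ
    v i = 2 * (rk * G) * x i
    w i = 2 * a i * G * n + n
    Σv : sum v ≡ 2 * (rk * G) * n
    Σv = trans (sym (*-distribˡ-sum (2 * (rk * G)) x)) (cong (2 * (rk * G) *_) Σx≡n)
    Σw : sum w ≡ 2 * (rk * G) * n + r * n
    Σw = trans (∑-distrib-+ (λ i → 2 * a i * G * n) (λ _ → n))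
               (cong₂ _+_ (trans (sum-cong-≗ (λ i → solve 3 (λ a g n → con 2 :* a :* g :* n := con 2 :* g :* n :* a) refl (a i) G n))
                                 (trans (sym (*-distribˡ-sum (2 * G * n) a))
                                        (trans (cong (2 * G * n *_) Σa≡rk) (solve 3 (λ g n rk → con 2 :* g :* n :* rk := con 2 :* (rk :* g) :* n) refl G n rk))))
                          (sum-const r n))
    wi≤vi+rn : w i ≤ v i + r * n
    wi≤vi+rn = begin
      w i                      ≡⟨ m∸n+n≡m (x≤ i) ⟨
      (w i ∸ v i) + v i        ≤⟨ +-monoˡ-≤ (v i) (lookup≤sum (λ i → w i ∸ v i) i) ⟩
      sum (λ i → w i ∸ v i) + v i
          ≡⟨ cong (_+ v i) (trans (∑-distrib-∸ w v x≤) (trans (cong₂ _∸_ Σw Σv) (m+n∸m≡n (2 * (rk * G) * n) (r * n)))) ⟩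
      r * n + v i              ≡⟨ +-comm (r * n) (v i) ⟩
      v i + r * n              ∎
    Gn+Gn≤vi+Gn : G * n + G * n ≤ v i + G * n
    Gn+Gn≤vi+Gn = begin
      G * n + G * n            ≡⟨ solve 2 (λ g n → g :* n :+ g :* n := con 2 :* con 1 :* g :* n) refl G n ⟩
      2 * 1 * G * n            ≤⟨ *-monoˡ-≤ n (*-monoˡ-≤ G (*-monoʳ-≤ 2 (1≤a i))) ⟩
      2 * a i * G * n          ≤⟨ m≤m+n _ n ⟩
      w i                      ≤⟨ wi≤vi+rn ⟩
      v i + r * n              ≤⟨ +-monoʳ-≤ (v i) (*-monoˡ-≤ n r≤G) ⟩
      v i + G * n              ∎
    n≤2rkx : n ≤ 2 * rk * x i
    n≤2rkx = *-cancelˡ-≤ G (≤-trans (+-cancelʳ-≤ (G * n) (G * n) (v i) Gn+Gn≤vi+Gn)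
                                    (≤-reflexive (solve 3 (λ rk g x → con 2 :* (rk :* g) :* x := g :* (con 2 :* rk :* x)) refl rk G (x i))))

  scaled-part-lower : ∀ a G k r m → 1 ≤ a → k * G ≤ m → (a * G ∸ 1) * (k * r * m) ≤ (a * m ∸ k) * (r * k * G)
  scaled-part-lower a zero      k r m _   _      = ≤-trans (≤-reflexive (cong (λ x → (x ∸ 1) * (k * r * m)) (*-zeroʳ a))) z≤n
  scaled-part-lower a G@(suc _) k r m 1≤a kG≤m = +-cancelʳ-≤ (k * r * m) _ _ (begin
    (a * G ∸ 1) * (k * r * m) + k * r * m
        ≡⟨ cong (_+ k * r * m) (trans (*-distribʳ-∸ (k * r * m) (a * G) 1) (cong (a * G * (k * r * m) ∸_) (*-identityˡ (k * r * m)))) ⟩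
    a * G * (k * r * m) ∸ k * r * m + k * r * m
        ≡⟨ m∸n+n≡m (≤-trans (≤-reflexive (sym (*-identityˡ (k * r * m)))) (*-monoˡ-≤ (k * r * m) (*-mono-≤ 1≤a (s≤s z≤n)))) ⟩
    a * G * (k * r * m)                          ≡⟨ solve 5 (λ a g k r m → a :* g :* (k :* r :* m) := a :* m :* (r :* k :* g)) refl a G k r m ⟩
    a * m * (r * k * G)                          ≡⟨ cong (_* (r * k * G)) (m∸n+n≡m k≤am) ⟨
    (a * m ∸ k + k) * (r * k * G)                ≡⟨ *-distribʳ-+ (r * k * G) (a * m ∸ k) k ⟩
    (a * m ∸ k) * (r * k * G) + k * (r * k * G)
        ≤⟨ +-monoʳ-≤ _ (≤-trans (≤-reflexive (solve 3 (λ k r g → k :* (r :* k :* g) := k :* r :* (k :* g)) refl k r G)) (*-monoʳ-≤ (k * r) kG≤m)) ⟩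
    (a * m ∸ k) * (r * k * G) + k * r * m        ∎)
    where
    open ≤-Reasoning
    k≤am : k ≤ a * m
    k≤am = ≤-trans (m≤m*n k G) (≤-trans kG≤m (≤-trans (≤-reflexive (sym (*-identityˡ m))) (*-monoˡ-≤ m 1≤a)))

module Rationals where

  open RatioBounds using (RatioExcess≤)
  open import Data.Nat as ℕ using (ℕ; zero; suc)
  import Data.Nat.Properties as ℕ
  open import Data.Integer as ℤ using (ℤ; +_; -[1+_])
  import Data.Integer.Properties as ℤ
  open import Data.Rational as ℚ using (ℚ; mkℚ; 0ℚ; 1ℚ; _/_)
  import Data.Rational.Properties as ℚ
  import Data.Rational.Unnormalised as ℚᵘ
  import Data.Rational.Unnormalised.Properties as ℚᵘ
  import Data.Nat.Coprimality as Coprimality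
  open import Data.Product using (Σ; _,_)
  open import Relation.Binary.PropositionalEquality
  open import Data.Rational.Solver using (module +-*-Solver)
  open +-*-Solver

  ℕ→ℚ≡mkℚ : ∀ n → ℕ→ℚ n ≡ mkℚ (+ n) 0 (Coprimality.sym (Coprimality.1-coprimeTo n))
  ℕ→ℚ≡mkℚ n = ℚ.normalize-coprime (Coprimality.sym (Coprimality.1-coprimeTo n))

  toℚᵘ-ℕ→ℚ : ∀ n → ℚ.toℚᵘ (ℕ→ℚ n) ≡ ℚᵘ.mkℚᵘ (+ n) 0
  toℚᵘ-ℕ→ℚ n rewrite ℕ→ℚ≡mkℚ n = refl

  ℕ→ℚ-+ : ∀ a b → ℕ→ℚ (a ℕ.+ b) ≡ ℕ→ℚ a ℚ.+ ℕ→ℚ b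
  ℕ→ℚ-+ a b = ℚ.toℚᵘ-injective (ℚᵘ.≃-trans (ℚᵘ.≃-reflexive (toℚᵘ-ℕ→ℚ (a ℕ.+ b)))
    (ℚᵘ.≃-trans sum≃ (ℚᵘ.≃-sym (ℚᵘ.≃-trans (ℚ.toℚᵘ-homo-+ (ℕ→ℚ a) (ℕ→ℚ b))
      (ℚᵘ.≃-reflexive (cong₂ ℚᵘ._+_ (toℚᵘ-ℕ→ℚ a) (toℚᵘ-ℕ→ℚ b)))))))
    where
    sum≃ : ℚᵘ.mkℚᵘ (+ (a ℕ.+ b)) 0 ℚᵘ.≃ (ℚᵘ.mkℚᵘ (+ a) 0 ℚᵘ.+ ℚᵘ.mkℚᵘ (+ b) 0)
    sum≃ = ℚᵘ.*≡* (cong (ℤ._* + 1) (trans (ℤ.pos-+ a b) (sym (cong₂ ℤ._+_ (ℤ.*-identityʳ (+ a)) (ℤ.*-identityʳ (+ b))))))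

  ℕ→ℚ-* : ∀ a b → ℕ→ℚ (a ℕ.* b) ≡ ℕ→ℚ a ℚ.* ℕ→ℚ b
  ℕ→ℚ-* a b = ℚ.toℚᵘ-injective (ℚᵘ.≃-trans (ℚᵘ.≃-reflexive (toℚᵘ-ℕ→ℚ (a ℕ.* b)))
    (ℚᵘ.≃-trans product≃ (ℚᵘ.≃-sym (ℚᵘ.≃-trans (ℚ.toℚᵘ-homo-* (ℕ→ℚ a) (ℕ→ℚ b))
      (ℚᵘ.≃-reflexive (cong₂ ℚᵘ._*_ (toℚᵘ-ℕ→ℚ a) (toℚᵘ-ℕ→ℚ b)))))))
    where
    product≃ : ℚᵘ.mkℚᵘ (+ (a ℕ.* b)) 0 ℚᵘ.≃ (ℚᵘ.mkℚᵘ (+ a) 0 ℚᵘ.* ℚᵘ.mkℚᵘ (+ b) 0)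
    product≃ = ℚᵘ.*≡* (cong (ℤ._* + 1) (ℤ.pos-* a b))

  ℕ→ℚ-mono-≤ : ∀ {a b} → a ℕ.≤ b → ℕ→ℚ a ℚ.≤ ℕ→ℚ b
  ℕ→ℚ-mono-≤ {a} {b} a≤b rewrite ℕ→ℚ≡mkℚ a | ℕ→ℚ≡mkℚ b = ℚ.*≤* (ℤ.*-monoʳ-≤-nonNeg (+ 1) (ℤ.+≤+ a≤b))

  ℕ→ℚ-cancel-≤ : ∀ {a b} → ℕ→ℚ a ℚ.≤ ℕ→ℚ b → a ℕ.≤ b
  ℕ→ℚ-cancel-≤ {a} {b} a≤b rewrite ℕ→ℚ≡mkℚ a | ℕ→ℚ≡mkℚ b with ℚ.drop-*≤* a≤b
  ... | a*1≤b*1 rewrite ℤ.*-identityʳ (+ a) | ℤ.*-identityʳ (+ b) = ℤ.drop‿+≤+ a*1≤b*1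

  ℕ→ℚ-nonNeg : ∀ n → ℚ.NonNegative (ℕ→ℚ n)
  ℕ→ℚ-nonNeg n rewrite ℕ→ℚ≡mkℚ n = _

  ℕ→ℚ-pos : ∀ n → ℚ.Positive (ℕ→ℚ (suc n))
  ℕ→ℚ-pos n rewrite ℕ→ℚ≡mkℚ (suc n) = _

  archimedean : ∀ β → 0ℚ ℚ.< β → Σ ℕ λ T → 1ℚ ℚ.≤ ℕ→ℚ (suc T) ℚ.* β
  archimedean (mkℚ (+ zero)  _ _) (ℚ.*<* (ℤ.+<+ ()))
  archimedean (mkℚ -[1+ _ ]  _ _) (ℚ.*<* ())
  archimedean β@(mkℚ (+ suc n) d _) _ = d , subst (1ℚ ℚ.≤_) (sym d*β≡n) (ℕ→ℚ-mono-≤ {1} {suc n} (ℕ.s≤s ℕ.z≤n))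
    where
    d*β≡n : ℕ→ℚ (suc d) ℚ.* β ≡ ℕ→ℚ (suc n)
    d*β≡n = ℚ.toℚᵘ-injective (ℚᵘ.≃-trans (ℚ.toℚᵘ-homo-* (ℕ→ℚ (suc d)) β)
              (ℚᵘ.≃-trans (ℚᵘ.≃-reflexive (cong (ℚᵘ._* ℚ.toℚᵘ β) (toℚᵘ-ℕ→ℚ (suc d))))
                (ℚᵘ.≃-trans cancel (ℚᵘ.≃-sym (ℚᵘ.≃-reflexive (toℚᵘ-ℕ→ℚ (suc n)))))))
      where
      cancel : (ℚᵘ.mkℚᵘ (+ suc d) 0 ℚᵘ.* ℚᵘ.mkℚᵘ (+ suc n) d) ℚᵘ.≃ ℚᵘ.mkℚᵘ (+ suc n) 0
      cancel = ℚᵘ.*≡* (trans (cong (ℤ._* + 1) (ℤ.*-comm (+ suc d) (+ suc n)))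
                      (trans (ℤ.*-identityʳ _) (cong (+ suc n ℤ.*_) (sym (ℤ.*-identityˡ (+ suc d))))))

  1/[1+_] : ℕ → ℚ
  1/[1+ G ] = + 1 / suc G

  1/[1+]-pos : ∀ G → 0ℚ ℚ.< 1/[1+ G ]
  1/[1+]-pos G rewrite ℚ.normalize-coprime {1} {G} (Coprimality.1-coprimeTo (suc G)) = ℚ.*<* (ℤ.+<+ (ℕ.s≤s ℕ.z≤n))

  1/[1+]-inverse : ∀ G → 1/[1+ G ] ℚ.* ℕ→ℚ (suc G) ≡ 1ℚ
  1/[1+]-inverse G = ℚ.toℚᵘ-injective (ℚᵘ.≃-trans (ℚ.toℚᵘ-homo-* 1/[1+ G ] (ℕ→ℚ (suc G)))
    (ℚᵘ.≃-trans (ℚᵘ.≃-reflexive (cong₂ ℚᵘ._*_ toℚᵘ-1/[1+] (toℚᵘ-ℕ→ℚ (suc G)))) cancel))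
    where
    toℚᵘ-1/[1+] : ℚ.toℚᵘ 1/[1+ G ] ≡ ℚᵘ.mkℚᵘ (+ 1) G
    toℚᵘ-1/[1+] rewrite ℚ.normalize-coprime {1} {G} (Coprimality.1-coprimeTo (suc G)) = refl
    cancel : (ℚᵘ.mkℚᵘ (+ 1) G ℚᵘ.* ℚᵘ.mkℚᵘ (+ suc G) 0) ℚᵘ.≃ ℚᵘ.mkℚᵘ (+ 1) 0
    cancel = ℚᵘ.*≡* (trans (ℤ.*-identityʳ _) (trans (ℤ.*-identityˡ _) (sym (trans (ℤ.*-identityˡ _) (cong +_ (ℕ.*-identityʳ (suc G)))))))

  clear-1/[1+] : ∀ G m n rk → ℕ→ℚ m ℚ.* ℕ→ℚ rk ℚ.≤ ℕ→ℚ n ℚ.+ 1/[1+ G ] ℚ.* ℕ→ℚ n ℚ.* ℕ→ℚ rk →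
                 m ℕ.* rk ℕ.* suc G ℕ.≤ n ℕ.* suc G ℕ.+ n ℕ.* rk
  clear-1/[1+] G m n rk bound = ℕ→ℚ-cancel-≤ {m ℕ.* rk ℕ.* suc G} {n ℕ.* suc G ℕ.+ n ℕ.* rk}
    (subst₂ ℚ._≤_ (sym lhs) (sym rhs) (ℚ.*-monoʳ-≤-nonNeg g {{ℕ→ℚ-nonNeg (suc G)}} bound))
    where
    g = ℕ→ℚ (suc G)
    lhs : ℕ→ℚ (m ℕ.* rk ℕ.* suc G) ≡ (ℕ→ℚ m ℚ.* ℕ→ℚ rk) ℚ.* g
    lhs = trans (ℕ→ℚ-* (m ℕ.* rk) (suc G)) (cong (ℚ._* g) (ℕ→ℚ-* m rk))
    rhs : ℕ→ℚ (n ℕ.* suc G ℕ.+ n ℕ.* rk) ≡ (ℕ→ℚ n ℚ.+ 1/[1+ G ] ℚ.* ℕ→ℚ n ℚ.* ℕ→ℚ rk) ℚ.* g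
    rhs = begin
      ℕ→ℚ (n ℕ.* suc G ℕ.+ n ℕ.* rk)
          ≡⟨ trans (ℕ→ℚ-+ (n ℕ.* suc G) (n ℕ.* rk)) (cong₂ ℚ._+_ (ℕ→ℚ-* n (suc G)) (ℕ→ℚ-* n rk)) ⟩
      ℕ→ℚ n ℚ.* g ℚ.+ ℕ→ℚ n ℚ.* ℕ→ℚ rk
          ≡⟨ cong (ℕ→ℚ n ℚ.* g ℚ.+_) (trans (cong (ℚ._* (ℕ→ℚ n ℚ.* ℕ→ℚ rk)) (1/[1+]-inverse G)) (ℚ.*-identityˡ _)) ⟨
      ℕ→ℚ n ℚ.* g ℚ.+ (1/[1+ G ] ℚ.* g) ℚ.* (ℕ→ℚ n ℚ.* ℕ→ℚ rk)
          ≡⟨ solve 4 (λ x y z v → x :* y :+ (z :* y) :* (x :* v) := (x :+ z :* x :* v) :* y) refl (ℕ→ℚ n) g 1/[1+ G ] (ℕ→ℚ rk) ⟩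
      (ℕ→ℚ n ℚ.+ 1/[1+ G ] ℚ.* ℕ→ℚ n ℚ.* ℕ→ℚ rk) ℚ.* g          ∎
      where open ≡-Reasoning

  RatioExcess≤⇒ℚ : ∀ T d d′ B B′ (β ε : ℚ) → 1ℚ ℚ.≤ ℕ→ℚ (suc T) ℚ.* β → 0ℚ ℚ.< ε → RatioExcess≤ (suc T) d B d′ B′ →
                   (ℕ→ℚ d ℚ.- (β ℚ.+ ε) ℚ.* ℕ→ℚ B) ℚ.* ℕ→ℚ B′ ℚ.≤ ℕ→ℚ d′ ℚ.* ℕ→ℚ B
  RatioExcess≤⇒ℚ T d d′ B B′ β ε 1≤tβ 0<ε excess = ℚ.*-cancelˡ-≤-pos t {{ℕ→ℚ-pos T}} (begin
    t ℚ.* ((x ℚ.- (β ℚ.+ ε) ℚ.* b) ℚ.* b′)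
        ≡⟨ solve 6 (λ t x β ε b b′ → t :* ((x :- (β :+ ε) :* b) :* b′)
                                   := t :* x :* b′ :+ (:- ((t :* β) :* (b :* b′)) :+ :- ((t :* ε) :* (b :* b′)))) refl t x β ε b b′ ⟩
    t ℚ.* x ℚ.* b′ ℚ.+ (ℚ.- ((t ℚ.* β) ℚ.* P) ℚ.+ ℚ.- ((t ℚ.* ε) ℚ.* P))
        ≤⟨ ℚ.+-monoʳ-≤ (t ℚ.* x ℚ.* b′) (ℚ.+-mono-≤ (ℚ.neg-antimono-≤ P≤tβP) (ℚ.neg-antimono-≤ 0≤tεP)) ⟩
    t ℚ.* x ℚ.* b′ ℚ.+ (ℚ.- P ℚ.+ ℚ.- 0ℚ)
        ≡⟨ solve 2 (λ z P → z :+ (:- P :+ :- con 0ℚ) := (z :+ P) :+ :- P :+ :- P) refl (t ℚ.* x ℚ.* b′) P ⟩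
    t ℚ.* x ℚ.* b′ ℚ.+ P ℚ.+ ℚ.- P ℚ.+ ℚ.- P
        ≤⟨ ℚ.+-monoˡ-≤ (ℚ.- P) (ℚ.+-monoˡ-≤ (ℚ.- P) (ℚ.+-monoˡ-≤ P excessℚ)) ⟩
    t ℚ.* y ℚ.* b ℚ.+ P ℚ.+ P ℚ.+ ℚ.- P ℚ.+ ℚ.- P
        ≡⟨ solve 4 (λ t y b P → ((t :* y :* b :+ P) :+ P) :+ :- P :+ :- P := t :* (y :* b)) refl t y b P ⟩
    t ℚ.* (y ℚ.* b) ∎)
    where
    open ℚ.≤-Reasoning
    t = ℕ→ℚ (suc T); x = ℕ→ℚ d; y = ℕ→ℚ d′; b = ℕ→ℚ B; b′ = ℕ→ℚ B′
    P = b ℚ.* b′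
    instance
      b-nonNeg = ℕ→ℚ-nonNeg B
      b′-nonNeg = ℕ→ℚ-nonNeg B′
      t-nonNeg = ℕ→ℚ-nonNeg (suc T)
      P-nonNeg : ℚ.NonNegative P
      P-nonNeg = ℚ.nonNeg*nonNeg⇒nonNeg b b′
    P≤tβP : P ℚ.≤ (t ℚ.* β) ℚ.* P
    P≤tβP = subst (ℚ._≤ (t ℚ.* β) ℚ.* P) (ℚ.*-identityˡ P) (ℚ.*-monoʳ-≤-nonNeg P 1≤tβ)
    0≤tεP : 0ℚ ℚ.≤ (t ℚ.* ε) ℚ.* P
    0≤tεP = subst (ℚ._≤ (t ℚ.* ε) ℚ.* P) (ℚ.*-zeroˡ P)
              (ℚ.*-monoʳ-≤-nonNeg P (subst (ℚ._≤ t ℚ.* ε) (ℚ.*-zeroʳ t) (ℚ.*-monoˡ-≤-nonNeg t (ℚ.<⇒≤ 0<ε))))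
    excessℚ : t ℚ.* x ℚ.* b′ ℚ.≤ t ℚ.* y ℚ.* b ℚ.+ P
    excessℚ = subst₂ ℚ._≤_ (trans (ℕ→ℚ-* (suc T ℕ.* d) B′) (cong (ℚ._* b′) (ℕ→ℚ-* (suc T) d)))
                           (trans (ℕ→ℚ-+ (suc T ℕ.* d′ ℕ.* B) (B ℕ.* B′))
                                  (cong₂ ℚ._+_ (trans (ℕ→ℚ-* (suc T ℕ.* d′) B) (cong (ℚ._* b) (ℕ→ℚ-* (suc T) d′))) (ℕ→ℚ-* B B′)))
                           (ℕ→ℚ-mono-≤ {suc T ℕ.* d ℕ.* B′} {suc T ℕ.* d′ ℕ.* B ℕ.+ B ℕ.* B′} excess)

module Construction (k r ℓ T : ℕ) (2≤k : 2 ≤ k) (2≤r : 2 ≤ r) (ℓ<k : ℓ < k) where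

  open FiniteSums
  open Binomials
  open PartitionTypes
  open Extensions
  open ValidTypes
  open ColouredGraphs
  open RatioBounds
  open PartSizes
  open Rationals
  open import Data.Nat using (ℕ; zero; suc; _+_; _*_; _∸_; _^_; _!; _≤_; _<_; z≤n; s≤s; NonZero; >-nonZero; >-nonZero⁻¹; _≤?_)
  open import Data.Nat.Properties
  open import Data.Nat.Divisibility using (m∣m*n)
  open import Data.Nat.Combinatorics using (_C_)
  open import Data.Fin using (Fin)
  open import Data.Fin.Properties using (all?; ¬∀⟶∃¬)
  open import Data.Fin.Subset using (Subset; ∣_∣; ∁)
  open import Data.Integer as ℤ using (ℤ; +_)
  import Data.Integer.Properties as ℤ
  open import Data.Product using (_×_; _,_; proj₁; proj₂)
  open import Relation.Nullary using (Dec; yes; no)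
  open import Relation.Binary.PropositionalEquality
  open import Data.Nat.Solver using (module +-*-Solver)
  open +-*-Solver

  -- (1 + T)β ≥ 1; G makes the error in comparing the two products at most 1/E, and the
  -- matching bound with γ = 1/(1 + G₀) gives |V_i| ≤ w_i n/rk + n/(2 rk G).
  U E G rk Z G₀ n₀ m₀ : ℕ
  U  = k ∸ ℓ
  E  = r * suc T
  G  = U * 2 * (E * U !)
  rk = r * k
  Z  = rk * G
  G₀ = 2 * G * rk * rk
  n₀ = 2 * (Z + 1) * k + 2 * rk * ℓ + suc k
  m₀ = k * G

  instance
    r≢0 : NonZero r
    r≢0 = >-nonZero (≤-trans (s≤s z≤n) 2≤r)
    k≢0 : NonZero k
    k≢0 = >-nonZero (≤-trans (s≤s z≤n) 2≤k)
    U≢0 : NonZero U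
    U≢0 = >-nonZero (m<n⇒0<n∸m ℓ<k)
    rk≢0 : NonZero rk
    rk≢0 = m*n≢0 r k
    E≢0 : NonZero E
    E≢0 = m*n≢0 r (suc T)
    G≢0 : NonZero G
    G≢0 = m*n≢0 (U * 2) (E * U !) {{m*n≢0 U 2}} {{m*n≢0 E (U !) {{E≢0}} {{U !≢0}}}}
    Z≢0 : NonZero Z
    Z≢0 = m*n≢0 rk G

  r≤G : r ≤ G
  r≤G = ≤-trans (m≤m*n r (suc T)) (≤-trans (m≤m*n E (U !) {{U !≢0}}) (m≤n*m (E * U !) (U * 2) {{m*n≢0 U 2}}))

  G≤Z : G ≤ Z
  G≤Z = m≤n*m G rk

  module Host {n} (n₀≤n : n₀ ≤ n) (H : CGraph k r n) {j σ} (valid : Valid k r j σ) (p : Fin n → Fin r)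
              (typed : EdgesTyped H p j σ) {M} (pm : PerfectMatching H M)
              (balanced : ∀ c → colourCount M c * rk * suc G₀ ≤ n * suc G₀ + n * rk) where

    types = edgeTypesOfValid 2≤r valid
    open EdgeTypes types
    open TypedGraph types H p typed

    X Y : Fin r → ℕ
    X i = weight i * G + 1
    Y i = weight i * G ∸ 1

    weight<rk : ∀ i → weight i < rk
    weight<rk i = ≤-trans (lookup<sum 2≤r weight weight-pos i) (≤-reflexive sum-weight)

    2rkG∣V∣≤ : ∀ i → 2 * (rk * G) * ∣ part p i ∣ ≤ 2 * weight i * G * n + n
    2rkG∣V∣≤ i = part-upper _ (weight i) n G (suc G₀) rk
      (weighted-sum-bound _ (λ c → edgeType c i) (colourCount M) (rk * suc G₀) _ (part≤matching pm i)
                          (λ c → ≤-trans (≤-reflexive (sym (*-assoc (colourCount M c) rk (suc G₀)))) (balanced c)))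
      (<⇒≤ (weight<rk i)) (n≤1+n G₀)

    Z∣V∣≤X[n∸k] : ∀ i → Z * ∣ part p i ∣ ≤ X i * (n ∸ k)
    Z∣V∣≤X[n∸k] i = part-upper-∸ Z _ (weight i) G n k (2rkG∣V∣≤ i)
      (≤-trans (*-monoˡ-≤ k (*-monoʳ-≤ 2 (+-monoˡ-≤ 1 (*-monoˡ-≤ G (<⇒≤ (weight<rk i))))))
               (≤-trans (m≤m+n _ (2 * rk * ℓ)) (≤-trans (m≤m+n _ (suc k)) n₀≤n)))

    ℓ≤∣V∣ : ∀ i → ℓ ≤ ∣ part p i ∣
    ℓ≤∣V∣ = part-lower (λ i → ∣ part p i ∣) weight n G rk ℓ 2rkG∣V∣≤ (sum-part p) sum-weight weight-pos r≤G
              (≤-trans (m≤n+m _ (2 * (Z + 1) * k)) (≤-trans (m≤m+n _ (suc k)) n₀≤n))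

    Y≤X : ∀ i → Y i ≤ X i
    Y≤X i = ≤-trans (m∸n≤m (weight i * G) 1) (m≤m+n (weight i * G) 1)

    X≤Y+2 : ∀ i → X i ≤ Y i + 2
    X≤Y+2 i = m+1≤m∸1+2 (weight i * G)
      where
      m+1≤m∸1+2 : ∀ m → m + 1 ≤ m ∸ 1 + 2
      m+1≤m∸1+2 zero    = s≤s z≤n
      m+1≤m∸1+2 (suc m) = ≤-reflexive (trans (+-comm (suc m) 1) (+-comm 2 m))

    X≤Z : ∀ i → X i ≤ Z
    X≤Z i = begin
      weight i * G + 1   ≤⟨ +-monoʳ-≤ (weight i * G) (>-nonZero⁻¹ G) ⟩
      weight i * G + G   ≡⟨ +-comm (weight i * G) G ⟩
      suc (weight i) * G ≤⟨ *-monoˡ-≤ G (weight<rk i) ⟩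
      rk * G             ∎
      where open ≤-Reasoning

    n∸k≢0 : NonZero (n ∸ k)
    n∸k≢0 = >-nonZero (m<n⇒0<n∸m (≤-trans (m≤n+m (suc k) _) n₀≤n))

    B : ℕ
    B = (n ∸ ℓ) C U

    [n∸k]^U≤B*U! : (n ∸ k) ^ U ≤ B * U !
    [n∸k]^U≤B*U! = subst (λ x → x ^ U ≤ B * U !) (trans (∸-+-assoc n ℓ U) (cong (n ∸_) (m+[n∸m]≡n (<⇒≤ ℓ<k)))) (∸^≤C*! (n ∸ ℓ) U)

    module Model (m : ℕ) (m₀≤m : m₀ ≤ m) where

      N : ℕ
      N = k * r * m

      instance
        N≢0 : NonZero N
        N≢0 = m*n≢0 (k * r) m {{m*n≢0 k r}} {{>-nonZero (≤-trans (*-mono-≤ (>-nonZero⁻¹ k) (>-nonZero⁻¹ G)) m₀≤m)}}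

      sizes = partitionOfSizes (λ i → weight i * m) N
                (trans (sym (*-distribʳ-sum m weight)) (trans (cong (_* m) sum-weight) (cong (_* m) (*-comm r k))))
      p′ : Fin N → Fin r
      p′ = proj₁ sizes
      ∣V′∣≡ : ∀ i → ∣ part p′ i ∣ ≡ weight i * m
      ∣V′∣≡ = proj₂ sizes

      K : CGraph k r N
      K = CompleteGraph.completeGraph types p′

      K∈F : InF K
      K∈F = j , σ , valid , p′ , CompleteGraph.completeGraph-typed types p′ , m∣m*n m , sizes-int
        where
        sizes-int : ∀ i → + (∣ part p′ i ∣ * (r * k)) ≡ (+ (r * j i) ℤ.+ σ) ℤ.* + N
        sizes-int i = begin
          + (∣ part p′ i ∣ * (r * k))   ≡⟨ cong (λ x → + (x * (r * k))) (∣V′∣≡ i) ⟩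
          + (weight i * m * (r * k))    ≡⟨ cong +_ (solve 4 (λ a m r k → a :* m :* (r :* k) := a :* (k :* r :* m)) refl (weight i) m r k) ⟩
          + (weight i * N)              ≡⟨ ℤ.pos-* (weight i) N ⟩
          + weight i ℤ.* + N            ≡⟨ cong (ℤ._* + N) (weight-int i) ⟩
          (+ (r * j i) ℤ.+ σ) ℤ.* + N   ∎
          where open ≡-Reasoning

      ℓ≤N : ℓ ≤ N
      ℓ≤N = ≤-trans (<⇒≤ ℓ<k) (≤-trans (m≤m*n k r {{r≢0}}) (m≤m*n (k * r) m {{m≢0}}))
        where
        m≢0 : NonZero m
        m≢0 = >-nonZero (≤-trans (*-mono-≤ (>-nonZero⁻¹ k) (>-nonZero⁻¹ G)) m₀≤m)

      B′ : ℕ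
      B′ = (N ∸ ℓ) C U

      B′*U!≤N^U : B′ * U ! ≤ N ^ U
      B′*U!≤N^U = ≤-trans (C*!≤^ (N ∸ ℓ) U) (^-monoˡ-≤ U (m∸n≤m N ℓ))

      module ColourComparison (S : Subset n) (S′ : Subset N) (same-type : type p S ≗ type p′ S′) (∣S′∣≡ℓ : ∣ S′ ∣ ≡ ℓ) (c : Fin r) where

        t s x y : Fin r → ℕ
        t = edgeType c
        s = type p′ S′
        x i = type p (∁ S) i
        y i = type p′ (∁ S′) i

        extensions-H : extensions p S t ≡ product (λ i → x i C[ t i - s i ])
        extensions-H = trans (extensions-formula p S t) (product-cong-≗ (λ i → cong (λ v → x i C[ t i - v ]) (same-type i)))

        ratio-misfit : ∀ i → t i < s i → RatioExcess≤ E (extensions p S t) B (extensions p′ S′ t) B′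
        ratio-misfit i ti<si = subst (λ a → RatioExcess≤ E a B (extensions p′ S′ t) B′)
                                     (sym (trans extensions-H (product-zero _ i (C[-]-> (x i) ti<si))))
                                     (RatioExcess≤-zero E B _ B′)

        ratio-fitting : (∀ i → s i ≤ t i) → RatioExcess≤ E (extensions p S t) B (extensions p′ S′ t) B′
        ratio-fitting s≤t = subst₂ (λ a b → RatioExcess≤ E a B b B′) (sym extensions-H′) (sym extensions-K′) core
          where
          open ≤-Reasoning
          extensions-H′ : extensions p S t ≡ product (λ i → x i C (t i ∸ s i))
          extensions-H′ = trans extensions-H (product-cong-≗ (λ i → C[-]-≤ (x i) (s≤t i)))
          extensions-K′ : extensions p′ S′ t ≡ product (λ i → y i C (t i ∸ s i))
          extensions-K′ = trans (extensions-formula p′ S′ t) (product-cong-≗ (λ i → C[-]-≤ (y i) (s≤t i)))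
          Σu≡U : sum (λ i → t i ∸ s i) ≡ U
          Σu≡U = trans (∑-distrib-∸ t s s≤t) (cong₂ _∸_ (edgeType-size c) (trans (sum-type p′ S′) ∣S′∣≡ℓ))
          Zx≤X[n∸k] : ∀ i → Z * x i ≤ X i * (n ∸ k)
          Zx≤X[n∸k] i = ≤-trans (*-monoʳ-≤ Z (≤-trans (m≤n+m (x i) (type p S i)) (≤-reflexive (type+free p S i)))) (Z∣V∣≤X[n∸k] i)
          YN≤[y∸u]Z : ∀ i → Y i * N ≤ (y i ∸ (t i ∸ s i)) * Z
          YN≤[y∸u]Z i = begin
            Y i * N                                    ≤⟨ scaled-part-lower (weight i) G k r m (weight-pos i) m₀≤m ⟩
            (weight i * m ∸ k) * Z                     ≡⟨ cong (λ v → (v ∸ k) * Z) (∣V′∣≡ i) ⟨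
            (∣ part p′ i ∣ ∸ k) * Z                    ≤⟨ *-monoˡ-≤ Z (∸-monoʳ-≤ ∣ part p′ i ∣ s+u≤k) ⟩
            (∣ part p′ i ∣ ∸ (s i + (t i ∸ s i))) * Z  ≡⟨ cong (λ v → (v ∸ (s i + (t i ∸ s i))) * Z) (type+free p′ S′ i) ⟨
            (s i + y i ∸ (s i + (t i ∸ s i))) * Z      ≡⟨ cong (_* Z) ([m+n]∸[m+o]≡n∸o (s i) (y i) (t i ∸ s i)) ⟩
            (y i ∸ (t i ∸ s i)) * Z                    ∎
            where
            s+u≤k : s i + (t i ∸ s i) ≤ k
            s+u≤k = ≤-trans (≤-reflexive (m+[n∸m]≡n (s≤t i))) (≤-trans (lookup≤sum t i) (≤-reflexive (edgeType-size c)))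
          core : RatioExcess≤ E (product (λ i → x i C (t i ∸ s i))) B (product (λ i → y i C (t i ∸ s i))) B′
          core = product-binomial-ratio (λ i → t i ∸ s i) x y X Y (n ∸ k) N Z E B B′ {{n∸k≢0}} Zx≤X[n∸k] YN≤[y∸u]Z Y≤X X≤Z X≤Y+2
                   (subst (λ V → V * 2 * (E * V !) ≤ Z) (sym Σu≡U) G≤Z)
                   (subst (λ V → (n ∸ k) ^ V ≤ B * V !) (sym Σu≡U) [n∸k]^U≤B*U!)
                   (subst (λ V → B′ * V ! ≤ N ^ V) (sym Σu≡U) B′*U!≤N^U)

        colour-ratio : RatioExcess≤ E (extensions p S t) B (extensions p′ S′ t) B′
        colour-ratio = fitting? (all? (λ i → s i ≤? t i))
          where
          fitting? : Dec (∀ i → s i ≤ t i) → RatioExcess≤ E (extensions p S t) B (extensions p′ S′ t) B′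
          fitting? (yes s≤t) = ratio-fitting s≤t
          fitting? (no s≰t)  = let (i , si≰ti) = ¬∀⟶∃¬ r _ (λ i → s i ≤? t i) s≰t in ratio-misfit i (≰⇒> si≰ti)

      degree-ratio : ∀ {d} → MinDegAtLeast H ℓ d → ∀ S′ → ∣ S′ ∣ ≡ ℓ → RatioExcess≤ (suc T) d B (deg K S′) B′
      degree-ratio δH≥d S′ ∣S′∣≡ℓ =
        RatioExcess≤-mono {suc T} {a = sum (λ c → extensions p S (edgeType c))} {b = B} {c = sum (λ c → extensions p′ S′ (edgeType c))} {d = B′}
          (≤-trans (δH≥d S ∣S∣≡ℓ) (deg≤sum-extensions S)) (CompleteGraph.sum-extensions≤deg-complete types p′ S′)
          (RatioExcess≤-sum (suc T) (λ c → extensions p S (edgeType c)) (λ c → extensions p′ S′ (edgeType c)) B B′ colour)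
        where
        s = type p′ S′
        Σs≡ℓ : sum s ≡ ℓ
        Σs≡ℓ = trans (sum-type p′ S′) ∣S′∣≡ℓ
        realised = subsetOfType p s (λ i → ≤-trans (lookup≤sum s i) (≤-trans (≤-reflexive Σs≡ℓ) (ℓ≤∣V∣ i)))
        S = proj₁ realised
        ∣S∣≡ℓ : ∣ S ∣ ≡ ℓ
        ∣S∣≡ℓ = trans (sym (sum-type p S)) (trans (sum-cong-≗ (proj₂ realised)) Σs≡ℓ)
        colour : ∀ c → RatioExcess≤ E (extensions p S (edgeType c)) B (extensions p′ S′ (edgeType c)) B′
        colour = ColourComparison.colour-ratio S S′ (proj₂ realised) ∣S′∣≡ℓ

open Rationals
open ColouredGraphs using (minDegree-attained)

lemma3p2 : (k r : ℕ) → 2 ≤ k → 2 ≤ r →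
    (β : ℚ) → 0ℚ <ℚ β → (ℓ : ℕ) → 1 ≤ ℓ → ℓ < k →
    ∃[ γ ] (0ℚ <ℚ γ × ∃[ n₀ ] ((n : ℕ) → n₀ ≤ n →
      (H : CGraph k r n) → InFstar H →
      (Σ (List (CEdge r n)) λ M → PerfectMatching H M ×
         ((i : Fin r) → ℕ→ℚ (colourCount M i) *ℚ ℕ→ℚ (r * k) ≤ℚ ℕ→ℚ n +ℚ γ *ℚ ℕ→ℚ n *ℚ ℕ→ℚ (r * k))) →
      -- colour counts: |M_i| · rk ≤ n + γ n rk, i.e. |M_i| ≤ n/(rk) + γ n
      -- δ_ℓ(H) ≤ (f_{ℓ,k,r} + β) C(n-ℓ,k-ℓ), with δ_ℓ(H) the largest d below
      (d : ℕ) → MinDegAtLeast H ℓ d →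
      DegAtMostFPlus ℓ k r d ((n ∸ ℓ) C (k ∸ ℓ)) β))
lemma3p2 k r 2≤k 2≤r β 0<β ℓ _ ℓ<k =
  1/[1+ G₀ ] , 1/[1+]-pos G₀ , n₀ , λ n n₀≤n H (j , σ , valid , p , typed) (M , pm , balanced) d δH≥d ε 0<ε →
    m₀ , λ m m₀≤m →
      let open Host n₀≤n H valid p typed pm (λ c → clear-1/[1+] G₀ (colourCount M c) n rk (balanced c))
          open Model m m₀≤m
          (S* , ∣S*∣≡ℓ , δK≥) = minDegree-attained K ℓ ℓ≤N
      in K , K∈F , deg K S* , δK≥ , RatioExcess≤⇒ℚ T d (deg K S*) B B′ β ε 1≤Tβ 0<ε (degree-ratio δH≥d S* ∣S*∣≡ℓ)
  where
  T = proj₁ (archimedean β 0<β)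
  1≤Tβ = proj₂ (archimedean β 0<β)
  open Construction k r ℓ T 2≤k 2≤r ℓ<k
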